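{- Let $\Lambda$ be a $2$-integral lattice of odd determinant and let $\Pi$ be a set of rational primes. Then every vector $v\in S_\Pi(\Lambda)$ satisfies $v\cdot v\equiv \mathrm{oddity}(\Lambda)/4 \pmod{2\mathbb{Z}_2}$.
   Context: A rational lattice $\Lambda$ is $2$-integral if $u\cdot v\in\mathbb{Z}_2$ for all $u,v\in\Lambda$; "odd determinant" means $\det\Lambda$ is a $2$-adic unit. The oddity is the $2$-adic invariant in $\mathbb{Z}/8$ of Conway–Sloane, Sphere Packings, Lattices and Groups, Chapter 15. The shadow is $S(\Lambda)=\{v\in\Lambda\otimes\mathbb{Q}: 2u\cdot v\equiv u\cdot u \pmod{2\mathbb{Z}_2}\text{ for all }u\in\Lambda\}$. For a set $\Pi$ of primes with complement $\overline{\Pi}$, the $\Pi$-dual $\Lambda^{*_\Pi}$ is the set of $v\in\Lambda\otimes\mathbb{Q}$ with $v\cdot u\in\mathbb{Z}_p$ for all $u\in\Lambda$, $p\in\Pi$, and $v\cdot u\in\mathbb{Z}_p$ for all $u\in\Lambda^*$, $p\notin\Pi$. The $\Pi$-shadow is $S_\Pi(\Lambda)=S(\Lambda^{*_{\overline{\Pi}}})$ if $2\in\Pi$, and $S_\Pi(\Lambda)=\sqrt{l}\,S(\sqrt{l}\,\Lambda^{*_{\overline{\Pi}}})$ if $2\notin\Pi$, where $l$ is the $2$-level of $\Lambda$ (the smallest positive integer $l$ such that $\sqrt{l}\,\Lambda^{*_{\{2\}}}$ is $2$-integral). -}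

module Defs where

open import Data.Nat as ℕ using (ℕ; zero; suc; _≤_)
open import Data.Nat.Divisibility using (_∣_)
open import Data.Nat.Primality using (Prime)
open import Data.Integer as ℤ using (ℤ; +_; ∣_∣)
open import Data.Rational using (ℚ; _+_; _*_; _-_; -_; 0ℚ; 1ℚ; _/_)
open ℚ using (numerator; denominatorℕ)
open import Data.Fin using (Fin; zero; suc; punchIn; cast; toℕ)
open import Data.List using (List; []; _∷_)
open import Data.Bool using (Bool; true; false; not)
open import Data.Product using (Σ; _×_; _,_)
open import Relation.Binary.PropositionalEquality using (_≡_)
open import Relation.Nullary using (¬_)
open import Data.Unit using (⊤)

Vec' : ℕ → Set
Vec' n = Fin n → ℚ

Mat : ℕ → Set
Mat n = Fin n → Fin n → ℚ

sumF : ∀ {n} → (Fin n → ℚ) → ℚ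
sumF {zero}  f = 0ℚ
sumF {suc n} f = f zero + sumF (λ i → f (suc i))

alt : ℕ → ℚ
alt zero          = 1ℚ
alt (suc zero)    = - 1ℚ
alt (suc (suc k)) = alt k

det : ∀ {n} → Mat n → ℚ
det {zero}  M = 1ℚ
det {suc n} M =
  sumF (λ j → alt (toℕ j) * M zero j * det (λ i k → M (suc i) (punchIn j k)))

form : ∀ {n} → Mat n → Vec' n → Vec' n → ℚ
form G x y = sumF (λ i → sumF (λ j → x i * G i j * y j))

Symmetric : ∀ {n} → Mat n → Set
Symmetric G = ∀ i j → G i j ≡ G j i

InZp : ℕ → ℚ → Set
InZp p q = ¬ (p ∣ denominatorℕ q)

Unit2 : ℚ → Set
Unit2 q = InZp 2 q × ¬ (2 ∣ ∣ numerator q ∣)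

CongMod2 : (m : ℕ) .{{_ : ℕ.NonZero m}} → ℚ → ℚ → Set
CongMod2 m x y = InZp 2 ((x - y) * (+ 1 / m))

IsInt : ℚ → Set
IsInt q = denominatorℕ q ≡ 1

-- The lattice Λ = ℤⁿ ⊂ ℚⁿ = Λ ⊗ ℚ with Gram matrix G

InΛ : ∀ {n} → Vec' n → Set
InΛ x = ∀ i → IsInt (x i)

InDual : ∀ {n} → Mat n → Vec' n → Set
InDual G v = ∀ u → InΛ u → IsInt (form G v u)

TwoIntegral : ∀ {n} → Mat n → Set
TwoIntegral G = ∀ u w → InΛ u → InΛ w → InZp 2 (form G u w)

-- Sets of primes are given by their (Boolean) characteristic function;
-- only its values on primes matter.
PrimeSet : Set
PrimeSet = ℕ → Bool

complement : PrimeSet → PrimeSet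
complement Π p = not (Π p)

InPiDual : ∀ {n} → Mat n → PrimeSet → Vec' n → Set
InPiDual G Π v =
  ∀ p → Prime p →
    (Π p ≡ true  → ∀ u → InΛ u      → InZp p (form G v u)) ×
    (Π p ≡ false → ∀ u → InDual G u → InZp p (form G v u))

InShadow : ∀ {n} → Mat n → (Vec' n → Set) → Vec' n → Set
InShadow G M v = ∀ u → M u → CongMod2 2 (+ 2 / 1 * form G u v) (form G u u)

-- membership of v in √l · S(√l · M), written in Λ ⊗ ℚ:
-- v = √l w with w ∈ S(√l M) iff  2 (√l u)·w ≡ (√l u)·(√l u), i.e.
-- 2 u·v ≡ l (u·u) (mod 2ℤ₂) for all u ∈ M
InScaledShadow : ∀ {n} → Mat n → ℕ → (Vec' n → Set) → Vec' n → Set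
InScaledShadow G l M v =
  ∀ u → M u → CongMod2 2 (+ 2 / 1 * form G u v) ((+ l / 1) * form G u u)

-- 2-level: smallest positive l with √l Λ^{*_{2}} 2-integral
twoSet : PrimeSet
twoSet 2 = true
twoSet _ = false

LevelProp : ∀ {n} → Mat n → ℕ → Set
LevelProp G l = ∀ u w → InPiDual G twoSet u → InPiDual G twoSet w →
                InZp 2 ((+ l / 1) * form G u w)

IsTwoLevel : ∀ {n} → Mat n → ℕ → Set
IsTwoLevel G l = 1 ≤ l × LevelProp G l × (∀ m → 1 ≤ m → LevelProp G m → l ≤ m)

InPiShadow : ∀ {n} → Mat n → PrimeSet → ℕ → Vec' n → Set
InPiShadow G Π l v =
  (Π 2 ≡ true  → InShadow G (InPiDual G (complement Π)) v) ×
  (Π 2 ≡ false → InScaledShadow G l (InPiDual G (complement Π)) v)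

-- Oddity (Conway–Sloane ch. 15) of a 2-adically unimodular form:
-- take a Jordan decomposition over ℤ_(2) into 1×1 blocks ⟨u⟩ (u a 2-adic
-- unit) and 2×2 even blocks [[2a,b],[b,2c]] (a,c ∈ ℤ₂, b a 2-adic unit);
-- the oddity is the sum of the 1×1 entries mod 8.

data Block : Set where
  one : ℚ → Block
  two : ℚ → ℚ → ℚ → Block

ValidBlock : Block → Set
ValidBlock (one u)     = Unit2 u
ValidBlock (two a b c) = InZp 2 a × Unit2 b × InZp 2 c

AllValid : List Block → Set
AllValid []       = ⊤
AllValid (b ∷ bs) = ValidBlock b × AllValid bs

size : List Block → ℕ
size []              = 0
size (one _ ∷ bs)    = suc (size bs)
size (two _ _ _ ∷ bs) = suc (suc (size bs))

blockDiag : (bs : List Block) → Mat (size bs)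
blockDiag []               ()   _
blockDiag (one u ∷ bs)     zero    zero    = u
blockDiag (one u ∷ bs)     zero    (suc j) = 0ℚ
blockDiag (one u ∷ bs)     (suc i) zero    = 0ℚ
blockDiag (one u ∷ bs)     (suc i) (suc j) = blockDiag bs i j
blockDiag (two a b c ∷ bs) zero          zero          = + 2 / 1 * a
blockDiag (two a b c ∷ bs) zero          (suc zero)    = b
blockDiag (two a b c ∷ bs) (suc zero)    zero          = b
blockDiag (two a b c ∷ bs) (suc zero)    (suc zero)    = + 2 / 1 * c
blockDiag (two a b c ∷ bs) zero          (suc (suc j)) = 0ℚ
blockDiag (two a b c ∷ bs) (suc zero)    (suc (suc j)) = 0ℚ
blockDiag (two a b c ∷ bs) (suc (suc i)) zero          = 0ℚ
blockDiag (two a b c ∷ bs) (suc (suc i)) (suc zero)    = 0ℚ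
blockDiag (two a b c ∷ bs) (suc (suc i)) (suc (suc j)) = blockDiag bs i j

oddSum : List Block → ℚ
oddSum []               = 0ℚ
oddSum (one u ∷ bs)     = u + oddSum bs
oddSum (two _ _ _ ∷ bs) = oddSum bs

col : ∀ {n} → Mat n → Fin n → Vec' n
col P j k = P k j

HasOddity : ∀ {n} → Mat n → ℤ → Set
HasOddity {n} G t =
  Σ (Mat n) λ P → Σ (List Block) λ bs → Σ (size bs ≡ n) λ eq →
    (∀ i j → InZp 2 (P i j)) × Unit2 (det P) × AllValid bs ×
    (∀ i j → form G (col P i) (col P j)
               ≡ blockDiag bs (cast (Relation.Binary.PropositionalEquality.sym eq) i)
                              (cast (Relation.Binary.PropositionalEquality.sym eq) j)) ×
    CongMod2 8 (oddSum bs) (t / 1)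

module Submission where

-- Work in the basis of columns pᵢ of the Jordan decomposition P, whose Gram matrix is the block
-- diagonal B. As det P ≢ 0, every x satisfies w·x = Σᵢ aᵢ (w·pᵢ) with a = B⁻¹ (pᵢ·x)ᵢ, and B⁻¹
-- is 2-integral; hence Λ^{*_{2}} is 2-integral and the 2-level is 1. Some odd multiple K pᵢ lies
-- in Λ ∩ Λ*, hence in every Π-dual, so for v in the Π-shadow 2K (pᵢ·v) ≡ K² (pᵢ·pᵢ), and dividing
-- by the 2-adic unit K gives 2 dᵢ ≡ Bᵢᵢ (mod 2ℤ₂) for dᵢ = pᵢ·v. Then v·v = dᵀ B⁻¹ d: a block ⟨u⟩
-- contributes d²/u ≡ u/4, an even 2×2 block contributes 2 (c d₀² − b d₀ d₁ + a d₁²)/(4ac − b²)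
-- ∈ 2ℤ₂, so v·v ≡ (Σ u)/4 ≡ oddity/4.

open import Defs
open import Data.Bool using (true; false)
open import Data.Empty using (⊥; ⊥-elim)
open import Data.Fin using (Fin; zero; suc; punchIn; toℕ; lift)
open import Data.Fin.Properties using (cast-is-id)
open import Data.Integer as ℤ using (ℤ; -[1+_])
import Data.Integer.DivMod as ℤ
import Data.Integer.Divisibility.Signed as ℤ
import Data.Integer.Properties as ℤ
open import Data.List using (List; []; _∷_)
open import Data.Nat as ℕ using (ℕ; zero; suc)
open import Data.Nat.Coprimality using (coprime-divisor; recompute) renaming (sym to coprime-sym)
open import Data.Nat.Divisibility using (_∣_; divides; ∣-trans; ∣1⇒≡1; _∣0; ∣-refl)
import Data.Nat.DivMod as ℕ
open import Data.Nat.Primality using (Prime; prime?; euclidsLemma; prime⇒nonTrivial)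
import Data.Nat.Properties as ℕ
open import Data.Product using (∃; _×_; _,_; proj₁; proj₂)
open import Data.Rational as ℚ using (ℚ; mkℚ; _+_; _*_; _-_; -_; _/_; 0ℚ; 1ℚ; 1/_; toℚᵘ)
open ℚ.ℚ using (denominatorℕ; numerator)
open import Data.Rational.Properties
open import Data.Rational.Solver using (module +-*-Solver)
import Data.Rational.Unnormalised as ℚᵘ
import Data.Rational.Unnormalised.Properties as ℚᵘ
open import Data.Sum using (_⊎_; inj₁; inj₂)
open import Relation.Binary.PropositionalEquality
open import Relation.Nullary using (¬_; yes; no)
open import Relation.Nullary.Decidable using (toWitness)
open +-*-Solver
open ≡-Reasoning

fromℤ : ℤ → ℚ
fromℤ a = a / 1

2ℚ : ℚ
2ℚ = fromℤ (ℤ.+ 2)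

½ : ℚ
½ = ℤ.+ 1 / 2

¼ : ℚ
¼ = ℤ.+ 1 / 4

fromℤ-toℚᵘ : ∀ a → toℚᵘ (fromℤ a) ℚᵘ.≃ ℚᵘ.mkℚᵘ a 0
fromℤ-toℚᵘ a = toℚᵘ-fromℚᵘ (ℚᵘ.mkℚᵘ a 0)

fromℤ-+ : ∀ a b → fromℤ (a ℤ.+ b) ≡ fromℤ a + fromℤ b
fromℤ-+ a b = toℚᵘ-injective (ℚᵘ.≃-sym (ℚᵘ.≃-trans (toℚᵘ-homo-+ (fromℤ a) (fromℤ b))
  (ℚᵘ.≃-trans (ℚᵘ.+-cong (fromℤ-toℚᵘ a) (fromℤ-toℚᵘ b))
  (ℚᵘ.≃-trans (ℚᵘ.*≡* (cong (ℤ._* ℤ.+ 1) (cong₂ ℤ._+_ (ℤ.*-identityʳ a) (ℤ.*-identityʳ b))))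
              (ℚᵘ.≃-sym (fromℤ-toℚᵘ (a ℤ.+ b)))))))

fromℤ-* : ∀ a b → fromℤ (a ℤ.* b) ≡ fromℤ a * fromℤ b
fromℤ-* a b = toℚᵘ-injective (ℚᵘ.≃-sym (ℚᵘ.≃-trans (toℚᵘ-homo-* (fromℤ a) (fromℤ b))
  (ℚᵘ.≃-trans (ℚᵘ.*-cong (fromℤ-toℚᵘ a) (fromℤ-toℚᵘ b)) (ℚᵘ.≃-sym (fromℤ-toℚᵘ (a ℤ.* b))))))

fromℤ-neg : ∀ a → fromℤ (ℤ.- a) ≡ - fromℤ a
fromℤ-neg a = toℚᵘ-injective (ℚᵘ.≃-sym (ℚᵘ.≃-trans (toℚᵘ-homo‿- (fromℤ a))
  (ℚᵘ.≃-trans (ℚᵘ.-‿cong (fromℤ-toℚᵘ a)) (ℚᵘ.≃-sym (fromℤ-toℚᵘ (ℤ.- a))))))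

fromℤ-injective : ∀ {a b} → fromℤ a ≡ fromℤ b → a ≡ b
fromℤ-injective {a} {b} eq
  with ℚᵘ.≃-trans (ℚᵘ.≃-sym (fromℤ-toℚᵘ a)) (ℚᵘ.≃-trans (toℚᵘ-cong eq) (fromℤ-toℚᵘ b))
... | ℚᵘ.*≡* a*1≡b*1 = trans (sym (ℤ.*-identityʳ a)) (trans a*1≡b*1 (ℤ.*-identityʳ b))

fromℤ≢0 : ∀ {a} → a ≢ ℤ.+ 0 → fromℤ a ≢ 0ℚ
fromℤ≢0 a≢0 fa≡0 = a≢0 (fromℤ-injective fa≡0)

fromℕ-* : ∀ m n → fromℤ (ℤ.+ (m ℕ.* n)) ≡ fromℤ (ℤ.+ m) * fromℤ (ℤ.+ n)
fromℕ-* m n = trans (cong fromℤ (ℤ.pos-* m n)) (fromℤ-* (ℤ.+ m) (ℤ.+ n))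

fromℕ-+ : ∀ m n → fromℤ (ℤ.+ (m ℕ.+ n)) ≡ fromℤ (ℤ.+ m) + fromℤ (ℤ.+ n)
fromℕ-+ m n = trans (cong fromℤ (ℤ.pos-+ m n)) (fromℤ-+ (ℤ.+ m) (ℤ.+ n))

fromℤ*¼ : ∀ t → fromℤ t * ¼ ≡ t / 4
fromℤ*¼ t = toℚᵘ-injective (ℚᵘ.≃-trans (toℚᵘ-homo-* (fromℤ t) ¼)
  (ℚᵘ.≃-trans (ℚᵘ.*-cong (fromℤ-toℚᵘ t) (toℚᵘ-fromℚᵘ (ℚᵘ.mkℚᵘ (ℤ.+ 1) 3)))
  (ℚᵘ.≃-trans (ℚᵘ.*≡* (cong (ℤ._* ℤ.+ 4) (ℤ.*-identityʳ t)))
              (ℚᵘ.≃-sym (toℚᵘ-fromℚᵘ (ℚᵘ.mkℚᵘ t 3))))))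

-- Junk value inv 0ℚ = 0ℚ; inv is only applied to 2-adic units.
inv : ℚ → ℚ
inv q with q ≟ 0ℚ
... | yes _ = 0ℚ
... | no q≢0 = (1/ q) {{ℚ.≢-nonZero q≢0}}

inv-inverseʳ : ∀ q → q ≢ 0ℚ → q * inv q ≡ 1ℚ
inv-inverseʳ q q≢0 with q ≟ 0ℚ
... | yes q≡0 = ⊥-elim (q≢0 q≡0)
... | no q≢0 = *-inverseʳ q {{ℚ.≢-nonZero q≢0}}

x≡-x⇒x≡0 : ∀ x → x ≡ - x → x ≡ 0ℚ
x≡-x⇒x≡0 x x≡-x = begin
  x              ≡⟨ solve 1 (λ x → x := con ½ :* (x :+ x)) refl x ⟩
  ½ * (x + x)    ≡⟨ cong (λ y → ½ * (x + y)) x≡-x ⟩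
  ½ * (x + - x)  ≡⟨ solve 1 (λ x → con ½ :* (x :+ :- x) := con 0ℚ) refl x ⟩
  0ℚ             ∎

x*y≡0⇒x≡0 : ∀ x y → x * y ≡ 0ℚ → y ≢ 0ℚ → x ≡ 0ℚ
x*y≡0⇒x≡0 x y xy≡0 y≢0 = begin
  x                ≡⟨ *-identityʳ x ⟨
  x * 1ℚ           ≡⟨ cong (x *_) (*-inverseʳ y) ⟨
  x * (y * 1/ y)   ≡⟨ *-assoc x y _ ⟨
  x * y * 1/ y     ≡⟨ cong (_* 1/ y) xy≡0 ⟩
  0ℚ * 1/ y        ≡⟨ *-zeroˡ (1/ y) ⟩
  0ℚ               ∎
  where instance _ = ℚ.≢-nonZero y≢0

0*-+ : ∀ x y → 0ℚ * x + y ≡ y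
0*-+ x y = trans (cong (_+ y) (*-zeroˡ x)) (+-identityˡ y)

-- Finite sums and determinants

sumF-cong : ∀ {n} {f g : Fin n → ℚ} → (∀ i → f i ≡ g i) → sumF f ≡ sumF g
sumF-cong {zero}  f≡g = refl
sumF-cong {suc n} f≡g = cong₂ _+_ (f≡g zero) (sumF-cong (λ i → f≡g (suc i)))

sumF-zero : ∀ {n} {f : Fin n → ℚ} → (∀ i → f i ≡ 0ℚ) → sumF f ≡ 0ℚ
sumF-zero {zero}  f≡0 = refl
sumF-zero {suc n} f≡0 = cong₂ _+_ (f≡0 zero) (sumF-zero (λ i → f≡0 (suc i)))

sumF-+ : ∀ {n} (f g : Fin n → ℚ) → sumF (λ i → f i + g i) ≡ sumF f + sumF g
sumF-+ {zero}  f g = refl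
sumF-+ {suc n} f g = trans (cong ((f zero + g zero) +_) (sumF-+ (λ i → f (suc i)) (λ i → g (suc i))))
  (solve 4 (λ a b c d → (a :+ b) :+ (c :+ d) := (a :+ c) :+ (b :+ d)) refl (f zero) (g zero) _ _)

sumF-*ˡ : ∀ {n} c (f : Fin n → ℚ) → sumF (λ i → c * f i) ≡ c * sumF f
sumF-*ˡ {zero}  c f = sym (*-zeroʳ c)
sumF-*ˡ {suc n} c f = trans (cong ((c * f zero) +_) (sumF-*ˡ c (λ i → f (suc i))))
  (sym (*-distribˡ-+ c (f zero) _))

sumF-*ʳ : ∀ {n} c (f : Fin n → ℚ) → sumF (λ i → f i * c) ≡ sumF f * c
sumF-*ʳ c f = trans (sumF-cong (λ i → *-comm (f i) c)) (trans (sumF-*ˡ c f) (*-comm c (sumF f)))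

sumF-neg : ∀ {n} (f : Fin n → ℚ) → sumF (λ i → - f i) ≡ - sumF f
sumF-neg {zero}  f = refl
sumF-neg {suc n} f = trans (cong ((- f zero) +_) (sumF-neg (λ i → f (suc i))))
  (sym (neg-distrib-+ (f zero) _))

sumF-comm : ∀ {m n} (f : Fin m → Fin n → ℚ) →
            sumF (λ i → sumF (λ j → f i j)) ≡ sumF (λ j → sumF (λ i → f i j))
sumF-comm {zero} {n} f = sym (sumF-zero {n} (λ _ → refl))
sumF-comm {suc m} f = begin
  sumF (f zero) + sumF (λ i → sumF (λ j → f (suc i) j))
    ≡⟨ cong (sumF (f zero) +_) (sumF-comm (λ i → f (suc i))) ⟩
  sumF (f zero) + sumF (λ j → sumF (λ i → f (suc i) j))
    ≡⟨ sumF-+ (f zero) (λ j → sumF (λ i → f (suc i) j)) ⟨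
  sumF (λ j → sumF (λ i → f i j)) ∎

sumF≢0⇒∃≢0 : ∀ {n} (f : Fin n → ℚ) → sumF f ≢ 0ℚ → ∃ λ j → f j ≢ 0ℚ
sumF≢0⇒∃≢0 {zero}  f Σ≢0 = ⊥-elim (Σ≢0 refl)
sumF≢0⇒∃≢0 {suc n} f Σ≢0 with f zero ≟ 0ℚ
... | no f₀≢0 = zero , f₀≢0
... | yes f₀≡0 =
  let j , fⱼ≢0 = sumF≢0⇒∃≢0 (λ i → f (suc i)) (λ Σ≡0 → Σ≢0 (cong₂ _+_ f₀≡0 Σ≡0))
  in suc j , fⱼ≢0

alt-suc : ∀ k → alt (suc k) ≡ - alt k
alt-suc zero    = refl
alt-suc (suc k) = begin
  alt k          ≡⟨ solve 1 (λ x → x := :- (:- x)) refl (alt k) ⟩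
  - (- alt k)    ≡⟨ cong -_ (alt-suc k) ⟨
  - alt (suc k)  ∎

-- There is no function extensionality, so minors must be shown to respect pointwise equality.
Extensional : ∀ {m k} → ((Fin m → Fin k) → ℚ) → Set
Extensional F = ∀ g h → (∀ x → g x ≡ h x) → F g ≡ F h

-- Expansion of a determinant along its first two rows a and b; F g is the determinant of the
-- remaining rows restricted to the columns g.
laplace₂ : ∀ m → ((Fin m → Fin (2 ℕ.+ m)) → ℚ) → (a b : Vec' (2 ℕ.+ m)) → ℚ
laplace₂ m F a b = sumF λ j → alt (toℕ j) * a j *
  sumF (λ k → alt (toℕ k) * b (punchIn j k) * F (λ x → punchIn j (punchIn k x)))

laplace₂-head : ∀ m → ((Fin m → Fin (2 ℕ.+ m)) → ℚ) → Vec' (2 ℕ.+ m) → ℚ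
laplace₂-head m F a = sumF λ k → alt (toℕ k) * a (suc k) * F (λ x → suc (punchIn k x))

laplace₂-tail : ∀ m → ((Fin m → Fin (2 ℕ.+ m)) → ℚ) → (a b : Vec' (2 ℕ.+ m)) → ℚ
laplace₂-tail m F a b = sumF λ j → alt (toℕ j) * a (suc j) *
  sumF (λ k → alt (toℕ k) * b (suc (punchIn j k)) * F (λ x → punchIn (suc j) (punchIn (suc k) x)))

sumF-alt-suc : ∀ {n} (f g : Vec' n) →
  sumF (λ k → alt (suc (toℕ k)) * f k * g k) ≡ - sumF (λ k → alt (toℕ k) * f k * g k)
sumF-alt-suc f g = trans (sumF-cong λ k →
    trans (cong (λ s → s * f k * g k) (alt-suc (toℕ k)))
          (solve 3 (λ s x y → :- s :* x :* y := :- (s :* x :* y)) refl (alt (toℕ k)) (f k) (g k)))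
  (sumF-neg (λ k → alt (toℕ k) * f k * g k))

laplace₂-split : ∀ m F a b → laplace₂ m F a b ≡
  a zero * laplace₂-head m F b - b zero * laplace₂-head m F a + laplace₂-tail m F a b
laplace₂-split m F a b = begin
  1ℚ * a zero * laplace₂-head m F b + sumF (λ j → alt (suc (toℕ j)) * a (suc j) *
    (1ℚ * b zero * F (λ x → suc (punchIn j x)) + sumF (λ k → alt (suc (toℕ k)) * b (suc (punchIn j k)) * T j k)))
    ≡⟨ cong₂ _+_ (cong (_* laplace₂-head m F b) (*-identityˡ (a zero))) (sumF-cong term) ⟩
  a zero * laplace₂-head m F b + sumF (λ j → - (b zero * headTerm j) + tailTerm j)
    ≡⟨ cong (a zero * laplace₂-head m F b +_) (sumF-+ (λ j → - (b zero * headTerm j)) tailTerm) ⟩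
  a zero * laplace₂-head m F b + (sumF (λ j → - (b zero * headTerm j)) + laplace₂-tail m F a b)
    ≡⟨ cong (λ s → a zero * laplace₂-head m F b + (s + laplace₂-tail m F a b))
         (trans (sumF-neg (λ j → b zero * headTerm j)) (cong -_ (sumF-*ˡ (b zero) headTerm))) ⟩
  a zero * laplace₂-head m F b + (- (b zero * laplace₂-head m F a) + laplace₂-tail m F a b)
    ≡⟨ solve 3 (λ x y z → x :+ (:- y :+ z) := x :- y :+ z) refl
         (a zero * laplace₂-head m F b) (b zero * laplace₂-head m F a) (laplace₂-tail m F a b) ⟩
  a zero * laplace₂-head m F b - b zero * laplace₂-head m F a + laplace₂-tail m F a b ∎
  where
  T : Fin (suc m) → Fin m → ℚ
  T j k = F (λ x → punchIn (suc j) (punchIn (suc k) x))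
  headTerm tailSum tailTerm : Fin (suc m) → ℚ
  headTerm j = alt (toℕ j) * a (suc j) * F (λ x → suc (punchIn j x))
  tailSum j = sumF (λ k → alt (toℕ k) * b (suc (punchIn j k)) * T j k)
  tailTerm j = alt (toℕ j) * a (suc j) * tailSum j
  term : ∀ j → alt (suc (toℕ j)) * a (suc j) *
    (1ℚ * b zero * F (λ x → suc (punchIn j x)) + sumF (λ k → alt (suc (toℕ k)) * b (suc (punchIn j k)) * T j k))
    ≡ - (b zero * headTerm j) + tailTerm j
  term j = begin
    alt (suc (toℕ j)) * a (suc j) * (1ℚ * b zero * F (λ x → suc (punchIn j x)) + _)
      ≡⟨ cong₂ (λ s t → s * a (suc j) * (1ℚ * b zero * F (λ x → suc (punchIn j x)) + t))
           (alt-suc (toℕ j)) (sumF-alt-suc (λ k → b (suc (punchIn j k))) (T j)) ⟩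
    - alt (toℕ j) * a (suc j) * (1ℚ * b zero * F (λ x → suc (punchIn j x)) + - tailSum j)
      ≡⟨ solve 5 (λ s x y f t → :- s :* x :* (con 1ℚ :* y :* f :+ :- t) := :- (y :* (s :* x :* f)) :+ s :* x :* t)
           refl (alt (toℕ j)) (a (suc j)) (b zero) (F (λ x → suc (punchIn j x))) (tailSum j) ⟩
    - (b zero * headTerm j) + tailTerm j ∎

laplace₂-tail-zero : ∀ F a b → laplace₂-tail 0 F a b ≡ 0ℚ
laplace₂-tail-zero F a b = sumF-zero (λ j → *-zeroʳ (alt (toℕ j) * a (suc j)))

laplace₂-tail-suc : ∀ m F a b → Extensional F →
  laplace₂-tail (suc m) F a b ≡ laplace₂ m (λ g → F (lift 1 g)) (λ i → a (suc i)) (λ i → b (suc i))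
laplace₂-tail-suc m F a b F-ext = sumF-cong λ j → cong (alt (toℕ j) * a (suc j) *_) (sumF-cong λ k →
  cong (alt (toℕ k) * b (suc (punchIn j k)) *_)
       (F-ext (λ x → punchIn (suc j) (punchIn (suc k) x)) (lift 1 (λ x → punchIn j (punchIn k x)))
              λ { zero → refl ; (suc x) → refl }))

Extensional-lift : ∀ {m k} (F : (Fin (suc m) → Fin (suc k)) → ℚ) →
                   Extensional F → Extensional (λ g → F (lift 1 g))
Extensional-lift F F-ext g h g≗h = F-ext (lift 1 g) (lift 1 h) λ { zero → refl ; (suc x) → cong suc (g≗h x) }

laplace₂-antisym : ∀ m F → Extensional F → ∀ a b → laplace₂ m F a b ≡ - laplace₂ m F b a

laplace₂-tail-antisym : ∀ m F → Extensional F → ∀ a b → laplace₂-tail m F a b ≡ - laplace₂-tail m F b a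

laplace₂-antisym m F F-ext a b = begin
  laplace₂ m F a b
    ≡⟨ laplace₂-split m F a b ⟩
  a zero * laplace₂-head m F b - b zero * laplace₂-head m F a + laplace₂-tail m F a b
    ≡⟨ cong (a zero * laplace₂-head m F b - b zero * laplace₂-head m F a +_) (laplace₂-tail-antisym m F F-ext a b) ⟩
  a zero * laplace₂-head m F b - b zero * laplace₂-head m F a + - laplace₂-tail m F b a
    ≡⟨ solve 3 (λ x y z → x :- y :+ :- z := :- (y :- x :+ z)) refl
         (a zero * laplace₂-head m F b) (b zero * laplace₂-head m F a) (laplace₂-tail m F b a) ⟩
  - (b zero * laplace₂-head m F a - a zero * laplace₂-head m F b + laplace₂-tail m F b a)
    ≡⟨ cong -_ (laplace₂-split m F b a) ⟨
  - laplace₂ m F b a ∎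

laplace₂-tail-antisym zero F F-ext a b =
  trans (laplace₂-tail-zero F a b) (cong -_ (sym (laplace₂-tail-zero F b a)))
laplace₂-tail-antisym (suc m) F F-ext a b = begin
  laplace₂-tail (suc m) F a b  ≡⟨ laplace₂-tail-suc m F a b F-ext ⟩
  laplace₂ m F' a' b'          ≡⟨ laplace₂-antisym m F' (Extensional-lift F F-ext) a' b' ⟩
  - laplace₂ m F' b' a'        ≡⟨ cong -_ (laplace₂-tail-suc m F b a F-ext) ⟨
  - laplace₂-tail (suc m) F b a ∎
  where
  F' : (Fin m → Fin (2 ℕ.+ m)) → ℚ
  F' g = F (lift 1 g)
  a' b' : Vec' (2 ℕ.+ m)
  a' i = a (suc i)
  b' i = b (suc i)

det-cong : ∀ {n} {M N : Mat n} → (∀ i j → M i j ≡ N i j) → det M ≡ det N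
det-cong {zero}  M≡N = refl
det-cong {suc n} M≡N = sumF-cong λ j →
  cong₂ (λ x d → alt (toℕ j) * x * d) (M≡N zero j) (det-cong (λ i k → M≡N (suc i) (punchIn j k)))

minor : ∀ {n} → Mat (suc n) → Fin (suc n) → Mat n
minor M j i k = M (suc i) (punchIn j k)

cofactorSum : ∀ {n} → Mat (suc n) → Vec' (suc n) → ℚ
cofactorSum M a = sumF (λ j → alt (toℕ j) * a j * det (minor M j))

lowerRows : ∀ {m} → Mat (2 ℕ.+ m) → (Fin m → Fin (2 ℕ.+ m)) → ℚ
lowerRows M g = det (λ i k → M (suc (suc i)) (g k))

lowerRows-ext : ∀ {m} (M : Mat (2 ℕ.+ m)) → Extensional (lowerRows M)
lowerRows-ext M g h g≗h = det-cong (λ i k → cong (M (suc (suc i))) (g≗h k))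

cofactorSum-row : ∀ {n} (M : Mat (suc n)) (k : Fin n) → cofactorSum M (M (suc k)) ≡ 0ℚ
cofactorSum-row {suc m} M zero =
  x≡-x⇒x≡0 _ (laplace₂-antisym m (lowerRows M) (lowerRows-ext M) (M (suc zero)) (M (suc zero)))
cofactorSum-row {suc m} M (suc k) = begin
  laplace₂ m (lowerRows M) (M (suc (suc k))) (M (suc zero))
    ≡⟨ laplace₂-antisym m (lowerRows M) (lowerRows-ext M) (M (suc (suc k))) (M (suc zero)) ⟩
  - laplace₂ m (lowerRows M) (M (suc zero)) (M (suc (suc k)))
    ≡⟨ cong -_ (sumF-zero λ j →
         trans (cong (alt (toℕ j) * M (suc zero) j *_) (cofactorSum-row (minor M j) k))
               (*-zeroʳ (alt (toℕ j) * M (suc zero) j))) ⟩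
  - 0ℚ ∎

cofactorSum-zero : ∀ {n} (M : Mat (suc n)) {a} → (∀ j → a j ≡ 0ℚ) → cofactorSum M a ≡ 0ℚ
cofactorSum-zero M {a} a≡0 = sumF-zero λ j → trans (cong (λ x → alt (toℕ j) * x * det (minor M j)) (a≡0 j))
  (solve 2 (λ s d → s :* con 0ℚ :* d := con 0ℚ) refl (alt (toℕ j)) (det (minor M j)))

cofactorSum-combination : ∀ {n} (M : Mat (suc n)) (z : Vec' (suc n)) →
  cofactorSum M (λ j → sumF (λ k → z k * M k j)) ≡ z zero * det M
cofactorSum-combination {n} M z = begin
  sumF (λ j → alt (toℕ j) * sumF (λ k → z k * M k j) * d j)
    ≡⟨ sumF-cong pull ⟩
  sumF (λ j → sumF (λ k → z k * (alt (toℕ j) * M k j * d j)))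
    ≡⟨ sumF-comm (λ j k → z k * (alt (toℕ j) * M k j * d j)) ⟩
  sumF (λ k → sumF (λ j → z k * (alt (toℕ j) * M k j * d j)))
    ≡⟨ sumF-cong (λ k → sumF-*ˡ (z k) (λ j → alt (toℕ j) * M k j * d j)) ⟩
  z zero * det M + sumF (λ k → z (suc k) * cofactorSum M (M (suc k)))
    ≡⟨ cong (z zero * det M +_) (sumF-zero λ k →
         trans (cong (z (suc k) *_) (cofactorSum-row M k)) (*-zeroʳ (z (suc k)))) ⟩
  z zero * det M + 0ℚ
    ≡⟨ +-identityʳ _ ⟩
  z zero * det M ∎
  where
  d : Fin (suc n) → ℚ
  d j = det (minor M j)
  pull : ∀ j → alt (toℕ j) * sumF (λ k → z k * M k j) * d j ≡ sumF (λ k → z k * (alt (toℕ j) * M k j * d j))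
  pull j = begin
    alt (toℕ j) * sumF (λ k → z k * M k j) * d j
      ≡⟨ cong (_* d j) (sumF-*ˡ (alt (toℕ j)) (λ k → z k * M k j)) ⟨
    sumF (λ k → alt (toℕ j) * (z k * M k j)) * d j
      ≡⟨ sumF-*ʳ (d j) (λ k → alt (toℕ j) * (z k * M k j)) ⟨
    sumF (λ k → alt (toℕ j) * (z k * M k j) * d j)
      ≡⟨ sumF-cong (λ k → solve 4 (λ s x y e → s :* (x :* y) :* e := x :* (s :* y :* e))
                                  refl (alt (toℕ j)) (z k) (M k j) (d j)) ⟩
    sumF (λ k → z k * (alt (toℕ j) * M k j * d j)) ∎

det≢0⇒rows-independent : ∀ {n} (M : Mat n) → det M ≢ 0ℚ → (z : Vec' n) →
  (∀ j → sumF (λ k → z k * M k j) ≡ 0ℚ) → ∀ k → z k ≡ 0ℚ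
det≢0⇒rows-independent {suc n} M det≢0 z zM≡0 =
  let j , termⱼ≢0 = sumF≢0⇒∃≢0 (λ j → alt (toℕ j) * M zero j * det (minor M j)) det≢0
  in λ where
    zero    → z₀≡0
    (suc k) → det≢0⇒rows-independent (minor M j) (minor≢0 j termⱼ≢0) (λ k → z (suc k)) (z₊M≡0 j) k
  where
  z₀≡0 : z zero ≡ 0ℚ
  z₀≡0 = x*y≡0⇒x≡0 (z zero) (det M)
    (trans (sym (cofactorSum-combination M z)) (cofactorSum-zero M zM≡0)) det≢0
  minor≢0 : ∀ j → alt (toℕ j) * M zero j * det (minor M j) ≢ 0ℚ → det (minor M j) ≢ 0ℚ
  minor≢0 j termⱼ≢0 d≡0 = termⱼ≢0 (trans (cong (alt (toℕ j) * M zero j *_) d≡0) (*-zeroʳ (alt (toℕ j) * M zero j)))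
  z₊M≡0 : ∀ j i → sumF (λ k → z (suc k) * minor M j k i) ≡ 0ℚ
  z₊M≡0 j i = begin
    sumF (λ k → z (suc k) * minor M j k i)
      ≡⟨ 0*-+ (M zero (punchIn j i)) _ ⟨
    0ℚ * M zero (punchIn j i) + sumF (λ k → z (suc k) * minor M j k i)
      ≡⟨ cong (λ x → x * M zero (punchIn j i) + sumF (λ k → z (suc k) * minor M j k i)) z₀≡0 ⟨
    z zero * M zero (punchIn j i) + sumF (λ k → z (suc k) * minor M j k i)
      ≡⟨ zM≡0 (punchIn j i) ⟩
    0ℚ ∎

-- Integers and 2-adic integers inside ℚ

record Integer (q : ℚ) : Set where
  constructor integer
  field
    value : ℤ
    q≡value : q ≡ fromℤ value

Integer-fromℤ : ∀ a → Integer (fromℤ a)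
Integer-fromℤ a = integer a refl

Integer-resp : ∀ {p q} → p ≡ q → Integer p → Integer q
Integer-resp refl p∈ℤ = p∈ℤ

Integer-+ : ∀ {p q} → Integer p → Integer q → Integer (p + q)
Integer-+ (integer a refl) (integer b refl) = integer (a ℤ.+ b) (sym (fromℤ-+ a b))

Integer-* : ∀ {p q} → Integer p → Integer q → Integer (p * q)
Integer-* (integer a refl) (integer b refl) = integer (a ℤ.* b) (sym (fromℤ-* a b))

Integer-sumF : ∀ {n} (f : Vec' n) → (∀ i → Integer (f i)) → Integer (sumF f)
Integer-sumF {zero}  f f∈ℤ = Integer-fromℤ (ℤ.+ 0)
Integer-sumF {suc n} f f∈ℤ = Integer-+ (f∈ℤ zero) (Integer-sumF (λ i → f (suc i)) (λ i → f∈ℤ (suc i)))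

Clears : ℕ → ℚ → Set
Clears K q = Integer (fromℤ (ℤ.+ K) * q)

Clears-* : ∀ {K q} L → Clears K q → Clears (L ℕ.* K) q
Clears-* {K} {q} L Kq∈ℤ = Integer-resp (sym eq) (Integer-* (Integer-fromℤ (ℤ.+ L)) Kq∈ℤ)
  where
  eq : fromℤ (ℤ.+ (L ℕ.* K)) * q ≡ fromℤ (ℤ.+ L) * (fromℤ (ℤ.+ K) * q)
  eq = trans (cong (_* q) (fromℕ-* L K)) (*-assoc (fromℤ (ℤ.+ L)) (fromℤ (ℤ.+ K)) q)

denominator-cleared : ∀ q → fromℤ (ℤ.+ denominatorℕ q) * q ≡ fromℤ (numerator q)
denominator-cleared q@(mkℚ n d _) = toℚᵘ-injective (ℚᵘ.≃-trans (toℚᵘ-homo-* (fromℤ (ℤ.+ suc d)) q)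
  (ℚᵘ.≃-trans (ℚᵘ.*-cong (fromℤ-toℚᵘ (ℤ.+ suc d)) (ℚᵘ.≃-refl {toℚᵘ q}))
  (ℚᵘ.≃-trans (ℚᵘ.*≡* eq) (ℚᵘ.≃-sym (fromℤ-toℚᵘ n)))))
  where
  eq : (ℤ.+ suc d ℤ.* n) ℤ.* ℤ.+ 1 ≡ n ℤ.* ℤ.+ (1 ℕ.* suc d)
  eq = trans (ℤ.*-identityʳ _) (trans (ℤ.*-comm (ℤ.+ suc d) n) (cong (λ x → n ℤ.* ℤ.+ x) (sym (ℕ.*-identityˡ (suc d)))))

Clears⇒denominator∣ : ∀ q K → Clears K q → denominatorℕ q ∣ K
Clears⇒denominator∣ q@(mkℚ n d n⊥d) K (integer a Kq≡a) =
  coprime-divisor (coprime-sym (recompute n⊥d))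
    (subst (suc d ∣_) (ℤ.abs-* n (ℤ.+ K)) (ℤ.∣⇒∣ᵤ (ℤ.divides a nK≡a[1+d])))
  where
  nK≡a[1+d] : n ℤ.* ℤ.+ K ≡ a ℤ.* ℤ.+ suc d
  nK≡a[1+d] with ℚᵘ.≃-trans (ℚᵘ.≃-sym (ℚᵘ.≃-trans (toℚᵘ-homo-* (fromℤ (ℤ.+ K)) q)
                   (ℚᵘ.*-cong (fromℤ-toℚᵘ (ℤ.+ K)) (ℚᵘ.≃-refl {toℚᵘ q}))))
                 (ℚᵘ.≃-trans (toℚᵘ-cong Kq≡a) (fromℤ-toℚᵘ a))
  ... | ℚᵘ.*≡* eq = begin
    n ℤ.* ℤ.+ K              ≡⟨ ℤ.*-comm n (ℤ.+ K) ⟩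
    ℤ.+ K ℤ.* n              ≡⟨ ℤ.*-identityʳ _ ⟨
    (ℤ.+ K ℤ.* n) ℤ.* ℤ.+ 1  ≡⟨ eq ⟩
    a ℤ.* ℤ.+ (1 ℕ.* suc d)  ≡⟨ cong (λ x → a ℤ.* ℤ.+ x) (ℕ.*-identityˡ (suc d)) ⟩
    a ℤ.* ℤ.+ suc d          ∎

Integer⇒IsInt : ∀ {q} → Integer q → IsInt q
Integer⇒IsInt {q} q∈ℤ = ∣1⇒≡1 (Clears⇒denominator∣ q 1 (Integer-resp (sym (*-identityˡ q)) q∈ℤ))

IsInt⇒Integer : ∀ {q} → IsInt q → Integer q
IsInt⇒Integer {q@(mkℚ n zero _)} refl = integer n (trans (sym (*-identityˡ q)) (denominator-cleared q))

IsInt⇒InZp : ∀ {p q} → Prime p → IsInt q → InZp p q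
IsInt⇒InZp {p} p-prime den≡1 p∣den with ∣1⇒≡1 (subst (p ∣_) den≡1 p∣den)
... | refl = ℕ.NonTrivial.nonTrivial (prime⇒nonTrivial p-prime)

Odd : ℕ → Set
Odd K = ¬ (2 ∣ K)

2-prime : Prime 2
2-prime = toWitness {a? = prime? 2} _

odd-* : ∀ {m n} → Odd m → Odd n → Odd (m ℕ.* n)
odd-* {m} {n} m-odd n-odd 2∣mn with euclidsLemma m n 2-prime 2∣mn
... | inj₁ 2∣m = m-odd 2∣m
... | inj₂ 2∣n = n-odd 2∣n

odd-1 : Odd 1
odd-1 2∣1 with ∣1⇒≡1 2∣1
... | ()

odd⇒≡1+2s : ∀ {K} → Odd K → ∃ λ s → K ≡ suc (s ℕ.* 2)
odd⇒≡1+2s {K} K-odd with K ℕ.% 2 | ℕ.m≡m%n+[m/n]*n K 2 | ℕ.m%n<n K 2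
... | zero        | K≡ | _ = ⊥-elim (K-odd (divides (K ℕ./ 2) K≡))
... | suc zero    | K≡ | _ = K ℕ./ 2 , K≡
... | suc (suc _) | _  | ℕ.s≤s (ℕ.s≤s ())

record ℤ₂ (q : ℚ) : Set where
  constructor ℤ₂-by
  field
    denominator     : ℕ
    denominator-odd : Odd denominator
    cleared         : Clears denominator q

ℤ₂-resp : ∀ {p q} → p ≡ q → ℤ₂ p → ℤ₂ q
ℤ₂-resp refl p∈ℤ₂ = p∈ℤ₂

Integer⇒ℤ₂ : ∀ {q} → Integer q → ℤ₂ q
Integer⇒ℤ₂ {q} q∈ℤ = ℤ₂-by 1 odd-1 (Integer-resp (sym (*-identityˡ q)) q∈ℤ)

ℤ₂-fromℤ : ∀ a → ℤ₂ (fromℤ a)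
ℤ₂-fromℤ a = Integer⇒ℤ₂ (Integer-fromℤ a)

ℤ₂-1 : ℤ₂ 1ℚ
ℤ₂-1 = ℤ₂-fromℤ (ℤ.+ 1)

ℤ₂-2 : ℤ₂ 2ℚ
ℤ₂-2 = ℤ₂-fromℤ (ℤ.+ 2)

ℤ₂-+ : ∀ {p q} → ℤ₂ p → ℤ₂ q → ℤ₂ (p + q)
ℤ₂-+ {p} {q} (ℤ₂-by K K-odd Kp∈ℤ) (ℤ₂-by L L-odd Lq∈ℤ) = ℤ₂-by (K ℕ.* L) (odd-* K-odd L-odd)
  (Integer-resp (sym eq) (Integer-+ (Integer-* (Integer-fromℤ (ℤ.+ L)) Kp∈ℤ) (Integer-* (Integer-fromℤ (ℤ.+ K)) Lq∈ℤ)))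
  where
  eq : fromℤ (ℤ.+ (K ℕ.* L)) * (p + q) ≡ fromℤ (ℤ.+ L) * (fromℤ (ℤ.+ K) * p) + fromℤ (ℤ.+ K) * (fromℤ (ℤ.+ L) * q)
  eq = trans (cong (_* (p + q)) (fromℕ-* K L))
    (solve 4 (λ k l p q → k :* l :* (p :+ q) := l :* (k :* p) :+ k :* (l :* q)) refl (fromℤ (ℤ.+ K)) (fromℤ (ℤ.+ L)) p q)

ℤ₂-* : ∀ {p q} → ℤ₂ p → ℤ₂ q → ℤ₂ (p * q)
ℤ₂-* {p} {q} (ℤ₂-by K K-odd Kp∈ℤ) (ℤ₂-by L L-odd Lq∈ℤ) = ℤ₂-by (K ℕ.* L) (odd-* K-odd L-odd)
  (Integer-resp (sym eq) (Integer-* Kp∈ℤ Lq∈ℤ))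
  where
  eq : fromℤ (ℤ.+ (K ℕ.* L)) * (p * q) ≡ fromℤ (ℤ.+ K) * p * (fromℤ (ℤ.+ L) * q)
  eq = trans (cong (_* (p * q)) (fromℕ-* K L))
    (solve 4 (λ k l p q → k :* l :* (p :* q) := k :* p :* (l :* q)) refl (fromℤ (ℤ.+ K)) (fromℤ (ℤ.+ L)) p q)

ℤ₂-neg : ∀ {p} → ℤ₂ p → ℤ₂ (- p)
ℤ₂-neg {p} p∈ℤ₂ =
  ℤ₂-resp (solve 1 (λ p → :- con 1ℚ :* p := :- p) refl p) (ℤ₂-* (ℤ₂-fromℤ (ℤ.- ℤ.+ 1)) p∈ℤ₂)

ℤ₂-- : ∀ {p q} → ℤ₂ p → ℤ₂ q → ℤ₂ (p - q)
ℤ₂-- p∈ℤ₂ q∈ℤ₂ = ℤ₂-+ p∈ℤ₂ (ℤ₂-neg q∈ℤ₂)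

ℤ₂-sumF : ∀ {n} (f : Vec' n) → (∀ i → ℤ₂ (f i)) → ℤ₂ (sumF f)
ℤ₂-sumF {zero}  f f∈ℤ₂ = ℤ₂-fromℤ (ℤ.+ 0)
ℤ₂-sumF {suc n} f f∈ℤ₂ = ℤ₂-+ (f∈ℤ₂ zero) (ℤ₂-sumF (λ i → f (suc i)) (λ i → f∈ℤ₂ (suc i)))

ℤ₂⇒InZp : ∀ {q} → ℤ₂ q → InZp 2 q
ℤ₂⇒InZp {q} (ℤ₂-by K K-odd Kq∈ℤ) 2∣den = K-odd (∣-trans 2∣den (Clears⇒denominator∣ q K Kq∈ℤ))

InZp⇒ℤ₂ : ∀ {q} → InZp 2 q → ℤ₂ q
InZp⇒ℤ₂ {q} den-odd = ℤ₂-by (denominatorℕ q) den-odd (integer (numerator q) (denominator-cleared q))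

Unit2⇒ℤ₂ : ∀ {u} → Unit2 u → ℤ₂ u
Unit2⇒ℤ₂ (den-odd , _) = InZp⇒ℤ₂ den-odd

Unit2⇒≢0 : ∀ {q} → Unit2 q → q ≢ 0ℚ
Unit2⇒≢0 (_ , num-odd) refl = num-odd (2 ∣0)

commonOddMultiple : ∀ {m} (R : Fin m → ℕ → Set) → (∀ {k K} L → R k K → R k (L ℕ.* K)) →
                    (∀ k → ∃ λ K → Odd K × R k K) → ∃ λ K → Odd K × ∀ k → R k K
commonOddMultiple {zero}  R R-* odd-witness = 1 , odd-1 , λ ()
commonOddMultiple {suc m} R R-* odd-witness
  with odd-witness zero | commonOddMultiple (λ k → R (suc k)) R-* (λ k → odd-witness (suc k))
... | K₀ , K₀-odd , R₀ | K₊ , K₊-odd , R₊ = K₀ ℕ.* K₊ , odd-* K₀-odd K₊-odd , λ where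
  zero    → subst (R zero) (ℕ.*-comm K₊ K₀) (R-* K₊ R₀)
  (suc k) → R-* K₀ (R₊ k)

clearVector : ∀ {n} (x : Vec' n) → (∀ i → ℤ₂ (x i)) → ∃ λ K → Odd K × ∀ i → Clears K (x i)
clearVector x x∈ℤ₂ = commonOddMultiple (λ i K → Clears K (x i)) Clears-*
  λ i → let open ℤ₂ (x∈ℤ₂ i) in denominator , denominator-odd , cleared

clearMatrix : ∀ {n} (M : Mat n) → (∀ i j → ℤ₂ (M i j)) → ∃ λ K → Odd K × ∀ i j → Clears K (M i j)
clearMatrix M M∈ℤ₂ = commonOddMultiple (λ i K → ∀ j → Clears K (M i j)) (λ L row j → Clears-* L (row j))
  λ i → clearVector (M i) (M∈ℤ₂ i)

-- Congruences modulo 2ℤ₂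

infix 4 _≡₂_

record _≡₂_ (x y : ℚ) : Set where
  constructor ≡₂-by
  field
    quotient     : ℚ
    quotient-ℤ₂  : ℤ₂ quotient
    x≡y+2q       : x ≡ y + 2ℚ * quotient

Even₂ Odd₂ : ℚ → Set
Even₂ x = x ≡₂ 0ℚ
Odd₂ x = x ≡₂ 1ℚ

≡₂-refl : ∀ {x} → x ≡₂ x
≡₂-refl {x} = ≡₂-by 0ℚ (ℤ₂-fromℤ (ℤ.+ 0)) (solve 1 (λ x → x := x :+ con 2ℚ :* con 0ℚ) refl x)

≡₂-trans : ∀ {x y z} → x ≡₂ y → y ≡₂ z → x ≡₂ z
≡₂-trans {z = z} (≡₂-by q q∈ℤ₂ refl) (≡₂-by r r∈ℤ₂ refl) = ≡₂-by (r + q) (ℤ₂-+ r∈ℤ₂ q∈ℤ₂)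
  (solve 3 (λ z r q → z :+ con 2ℚ :* r :+ con 2ℚ :* q := z :+ con 2ℚ :* (r :+ q)) refl z r q)

≡₂-+ : ∀ {x y u v} → x ≡₂ y → u ≡₂ v → x + u ≡₂ y + v
≡₂-+ {y = y} {v = v} (≡₂-by q q∈ℤ₂ refl) (≡₂-by r r∈ℤ₂ refl) = ≡₂-by (q + r) (ℤ₂-+ q∈ℤ₂ r∈ℤ₂)
  (solve 4 (λ y v q r → y :+ con 2ℚ :* q :+ (v :+ con 2ℚ :* r) := y :+ v :+ con 2ℚ :* (q :+ r)) refl y v q r)

≡₂-*ˡ : ∀ {c x y} → ℤ₂ c → x ≡₂ y → c * x ≡₂ c * y
≡₂-*ˡ {c} {y = y} c∈ℤ₂ (≡₂-by q q∈ℤ₂ refl) = ≡₂-by (c * q) (ℤ₂-* c∈ℤ₂ q∈ℤ₂)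
  (solve 3 (λ c y q → c :* (y :+ con 2ℚ :* q) := c :* y :+ con 2ℚ :* (c :* q)) refl c y q)

2*-Even₂ : ∀ {q} → ℤ₂ q → Even₂ (2ℚ * q)
2*-Even₂ {q} q∈ℤ₂ = ≡₂-by q q∈ℤ₂ (sym (+-identityˡ (2ℚ * q)))

CongMod2⇒≡₂ : ∀ {x y} → CongMod2 2 x y → x ≡₂ y
CongMod2⇒≡₂ {x} {y} h = ≡₂-by ((x - y) * ½) (InZp⇒ℤ₂ h)
  (solve 2 (λ x y → x := y :+ con 2ℚ :* ((x :- y) :* con ½)) refl x y)

≡₂⇒CongMod2 : ∀ {x y} → x ≡₂ y → CongMod2 2 x y
≡₂⇒CongMod2 {y = y} (≡₂-by q q∈ℤ₂ refl) =
  ℤ₂⇒InZp (ℤ₂-resp (solve 2 (λ y q → q := (y :+ con 2ℚ :* q :- y) :* con ½) refl y q) q∈ℤ₂)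

≡₂-cleared : ∀ {K x y} b → Odd K → fromℤ (ℤ.+ K) * (x - y) ≡ 2ℚ * fromℤ b → x ≡₂ y
≡₂-cleared {K} {x} {y} b K-odd eq = ≡₂-by (½ * (x - y))
  (ℤ₂-by K K-odd (integer b (begin
    k * (½ * (x - y))   ≡⟨ solve 3 (λ k x y → k :* (con ½ :* (x :- y)) := con ½ :* (k :* (x :- y))) refl k x y ⟩
    ½ * (k * (x - y))   ≡⟨ cong (½ *_) eq ⟩
    ½ * (2ℚ * fromℤ b)  ≡⟨ solve 1 (λ b → con ½ :* (con 2ℚ :* b) := b) refl (fromℤ b) ⟩
    fromℤ b             ∎)))
  (solve 2 (λ x y → x := y :+ con 2ℚ :* (con ½ :* (x :- y))) refl x y)
  where
  k : ℚ
  k = fromℤ (ℤ.+ K)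

parity : ∀ {x} → ℤ₂ x → Even₂ x ⊎ Odd₂ x
parity {x} (ℤ₂-by K K-odd (integer a Kx≡a)) with odd⇒≡1+2s K-odd
... | s , refl with a ℤ.%ℕ 2 | ℤ.a≡a%ℕn+[a/ℕn]*n a 2 | ℤ.n%ℕd<d a 2
...   | zero        | a≡ | _ = inj₁ (≡₂-cleared (a ℤ./ℕ 2) K-odd (begin
  k * (x - 0ℚ)                  ≡⟨ solve 2 (λ k x → k :* (x :- con 0ℚ) := k :* x) refl k x ⟩
  k * x                         ≡⟨ Kx≡a ⟩
  fromℤ a                       ≡⟨ cong fromℤ (trans a≡ (trans (ℤ.+-identityˡ (a ℤ./ℕ 2 ℤ.* ℤ.+ 2))
                                                               (ℤ.*-comm (a ℤ./ℕ 2) (ℤ.+ 2)))) ⟩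
  fromℤ (ℤ.+ 2 ℤ.* (a ℤ./ℕ 2))  ≡⟨ fromℤ-* (ℤ.+ 2) (a ℤ./ℕ 2) ⟩
  2ℚ * fromℤ (a ℤ./ℕ 2)         ∎))
  where
  k : ℚ
  k = fromℤ (ℤ.+ K)
...   | suc zero    | a≡ | _ = inj₂ (≡₂-cleared (a ℤ./ℕ 2 ℤ.- ℤ.+ s) K-odd (begin
  k * (x - 1ℚ)  ≡⟨ solve 2 (λ k x → k :* (x :- con 1ℚ) := k :* x :- k) refl k x ⟩
  k * x - k     ≡⟨ cong₂ _-_ Kx≡a (fromℕ-+ 1 (s ℕ.* 2)) ⟩
  fromℤ a - (1ℚ + fromℤ (ℤ.+ (s ℕ.* 2)))
    ≡⟨ cong₂ (λ u v → u - (1ℚ + v))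
             (trans (cong fromℤ a≡) (fromℤ-+ (ℤ.+ 1) (a ℤ./ℕ 2 ℤ.* ℤ.+ 2))) (fromℕ-* s 2) ⟩
  1ℚ + fromℤ (a ℤ./ℕ 2 ℤ.* ℤ.+ 2) - (1ℚ + fromℤ (ℤ.+ s) * 2ℚ)
    ≡⟨ cong (λ u → 1ℚ + u - (1ℚ + fromℤ (ℤ.+ s) * 2ℚ)) (fromℤ-* (a ℤ./ℕ 2) (ℤ.+ 2)) ⟩
  1ℚ + fromℤ (a ℤ./ℕ 2) * 2ℚ - (1ℚ + fromℤ (ℤ.+ s) * 2ℚ)
    ≡⟨ solve 2 (λ q s → con 1ℚ :+ q :* con 2ℚ :- (con 1ℚ :+ s :* con 2ℚ) := con 2ℚ :* (q :- s)) refl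
         (fromℤ (a ℤ./ℕ 2)) (fromℤ (ℤ.+ s)) ⟩
  2ℚ * (fromℤ (a ℤ./ℕ 2) - fromℤ (ℤ.+ s))
    ≡⟨ cong (λ u → 2ℚ * (fromℤ (a ℤ./ℕ 2) + u)) (fromℤ-neg (ℤ.+ s)) ⟨
  2ℚ * (fromℤ (a ℤ./ℕ 2) + fromℤ (ℤ.- ℤ.+ s))
    ≡⟨ cong (2ℚ *_) (fromℤ-+ (a ℤ./ℕ 2) (ℤ.- ℤ.+ s)) ⟨
  2ℚ * fromℤ (a ℤ./ℕ 2 ℤ.- ℤ.+ s) ∎))
  where
  k : ℚ
  k = fromℤ (ℤ.+ K)
...   | suc (suc _) | _  | ℕ.s≤s (ℕ.s≤s ())

¬ℤ₂-½ : ¬ ℤ₂ ½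
¬ℤ₂-½ ½∈ℤ₂ = ℤ₂⇒InZp ½∈ℤ₂ ∣-refl

Even₂-Odd₂-disjoint : ∀ {x} → Even₂ x → Odd₂ x → ⊥
Even₂-Odd₂-disjoint {x} (≡₂-by q q∈ℤ₂ x≡2q) (≡₂-by r r∈ℤ₂ x≡1+2r) =
  ¬ℤ₂-½ (ℤ₂-resp q-r≡½ (ℤ₂-- q∈ℤ₂ r∈ℤ₂))
  where
  q-r≡½ : q - r ≡ ½
  q-r≡½ = begin
    q - r
      ≡⟨ solve 2 (λ q r → q :- r := con ½ :* (con 0ℚ :+ con 2ℚ :* q :- con 2ℚ :* r)) refl q r ⟩
    ½ * (0ℚ + 2ℚ * q - 2ℚ * r)
      ≡⟨ cong (λ u → ½ * (u - 2ℚ * r)) (trans (sym x≡2q) x≡1+2r) ⟩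
    ½ * (1ℚ + 2ℚ * r - 2ℚ * r)
      ≡⟨ solve 1 (λ r → con ½ :* (con 1ℚ :+ con 2ℚ :* r :- con 2ℚ :* r) := con ½) refl r ⟩
    ½ ∎

record Invertible₂ (x : ℚ) : Set where
  field
    inv-ℤ₂   : ℤ₂ (inv x)
    inverseʳ : x * inv x ≡ 1ℚ

invertible₂ : ∀ {x w} → ℤ₂ w → x * w ≡ 1ℚ → Invertible₂ x
invertible₂ {x} {w} w∈ℤ₂ xw≡1 = record { inv-ℤ₂ = ℤ₂-resp w≡inv w∈ℤ₂ ; inverseʳ = x*inv≡1 }
  where
  x≢0 : x ≢ 0ℚ
  x≢0 refl = 1≢0 (trans (sym xw≡1) (*-zeroˡ w))
  x*inv≡1 : x * inv x ≡ 1ℚ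
  x*inv≡1 = inv-inverseʳ x x≢0
  w≡inv : w ≡ inv x
  w≡inv = begin
    w                  ≡⟨ *-identityʳ w ⟨
    w * 1ℚ             ≡⟨ cong (w *_) x*inv≡1 ⟨
    w * (x * inv x)    ≡⟨ solve 3 (λ w x i → w :* (x :* i) := x :* w :* i) refl w x (inv x) ⟩
    x * w * inv x      ≡⟨ cong (_* inv x) xw≡1 ⟩
    1ℚ * inv x         ≡⟨ *-identityˡ (inv x) ⟩
    inv x              ∎

ℤ₂-ratio : ∀ c N → Odd ℤ.∣ N ∣ → ℤ₂ (fromℤ c * inv (fromℤ N))
ℤ₂-ratio c N@(ℤ.+ n) n-odd = ℤ₂-by n n-odd (integer c (begin
  fromℤ N * (fromℤ c * inv (fromℤ N))
    ≡⟨ solve 3 (λ n c i → n :* (c :* i) := c :* (n :* i)) refl (fromℤ N) (fromℤ c) (inv (fromℤ N)) ⟩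
  fromℤ c * (fromℤ N * inv (fromℤ N))
    ≡⟨ cong (fromℤ c *_) (inv-inverseʳ (fromℤ N) (fromℤ≢0 {N} (λ { refl → n-odd (2 ∣0) }))) ⟩
  fromℤ c * 1ℚ
    ≡⟨ *-identityʳ (fromℤ c) ⟩
  fromℤ c ∎))
ℤ₂-ratio c N@(-[1+ n ]) n-odd = ℤ₂-by (suc n) n-odd (integer (ℤ.- c) (begin
  fromℤ (ℤ.+ suc n) * (fromℤ c * inv (fromℤ N))
    ≡⟨ cong (λ m → m * (fromℤ c * inv (fromℤ N))) (fromℤ-neg N) ⟩
  - fromℤ N * (fromℤ c * inv (fromℤ N))
    ≡⟨ solve 3 (λ n c i → :- n :* (c :* i) := :- c :* (n :* i)) refl (fromℤ N) (fromℤ c) (inv (fromℤ N)) ⟩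
  - fromℤ c * (fromℤ N * inv (fromℤ N))
    ≡⟨ cong (- fromℤ c *_) (inv-inverseʳ (fromℤ N) (fromℤ≢0 {N} λ ())) ⟩
  - fromℤ c * 1ℚ
    ≡⟨ *-identityʳ (- fromℤ c) ⟩
  - fromℤ c
    ≡⟨ fromℤ-neg c ⟨
  fromℤ (ℤ.- c) ∎))

cleared-odd⇒Invertible₂ : ∀ {x} K N → fromℤ (ℤ.+ K) * x ≡ fromℤ N → Odd ℤ.∣ N ∣ → Invertible₂ x
cleared-odd⇒Invertible₂ {x} K N Kx≡N N-odd = invertible₂ (ℤ₂-ratio (ℤ.+ K) N N-odd) (begin
  x * (fromℤ (ℤ.+ K) * inv (fromℤ N))  ≡⟨ *-assoc x (fromℤ (ℤ.+ K)) _ ⟨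
  x * fromℤ (ℤ.+ K) * inv (fromℤ N)    ≡⟨ cong (_* inv (fromℤ N)) (trans (*-comm x (fromℤ (ℤ.+ K))) Kx≡N) ⟩
  fromℤ N * inv (fromℤ N)              ≡⟨ inv-inverseʳ (fromℤ N) (fromℤ≢0 {N} λ { refl → N-odd (2 ∣0) }) ⟩
  1ℚ                                   ∎)

Unit2⇒Invertible₂ : ∀ {u} → Unit2 u → Invertible₂ u
Unit2⇒Invertible₂ {u} (_ , num-odd) = cleared-odd⇒Invertible₂ (denominatorℕ u) (numerator u) (denominator-cleared u) num-odd

Odd₂⇒Invertible₂ : ∀ {x} → Odd₂ x → Invertible₂ x
Odd₂⇒Invertible₂ {x} (≡₂-by y (ℤ₂-by K K-odd (integer b Ky≡b)) refl) =
  cleared-odd⇒Invertible₂ K (ℤ.+ K ℤ.+ ℤ.+ 2 ℤ.* b) Kx≡K+2b K+2b-odd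
  where
  k : ℚ
  k = fromℤ (ℤ.+ K)
  Kx≡K+2b : k * (1ℚ + 2ℚ * y) ≡ fromℤ (ℤ.+ K ℤ.+ ℤ.+ 2 ℤ.* b)
  Kx≡K+2b = begin
    k * (1ℚ + 2ℚ * y)
      ≡⟨ solve 2 (λ k y → k :* (con 1ℚ :+ con 2ℚ :* y) := k :+ con 2ℚ :* (k :* y)) refl k y ⟩
    k + 2ℚ * (k * y)                ≡⟨ cong (λ z → k + 2ℚ * z) Ky≡b ⟩
    k + 2ℚ * fromℤ b                ≡⟨ cong (λ z → k + z) (fromℤ-* (ℤ.+ 2) b) ⟨
    k + fromℤ (ℤ.+ 2 ℤ.* b)         ≡⟨ fromℤ-+ (ℤ.+ K) (ℤ.+ 2 ℤ.* b) ⟨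
    fromℤ (ℤ.+ K ℤ.+ ℤ.+ 2 ℤ.* b)   ∎
  K+2b-odd : Odd ℤ.∣ ℤ.+ K ℤ.+ ℤ.+ 2 ℤ.* b ∣
  K+2b-odd 2∣K+2b = K-odd (ℤ.∣⇒∣ᵤ {ℤ.+ 2} {ℤ.+ K}
    (ℤ.∣m+n∣n⇒∣m (ℤ.∣ᵤ⇒∣ {ℤ.+ 2} {ℤ.+ K ℤ.+ ℤ.+ 2 ℤ.* b} 2∣K+2b)
                  (ℤ.∣m⇒∣m*n {ℤ.+ 2} {ℤ.+ 2} b ℤ.∣-refl)))

inverse⇒Odd₂ : ∀ {x w} → ℤ₂ x → ℤ₂ w → x * w ≡ 1ℚ → Odd₂ x
inverse⇒Odd₂ {x} {w} x∈ℤ₂ w∈ℤ₂ xw≡1 with parity x∈ℤ₂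
... | inj₂ x-odd = x-odd
... | inj₁ (≡₂-by q q∈ℤ₂ refl) = ⊥-elim (Even₂-Odd₂-disjoint 1-even ≡₂-refl)
  where
  1-even : Even₂ 1ℚ
  1-even = ≡₂-by (q * w) (ℤ₂-* q∈ℤ₂ w∈ℤ₂)
    (trans (sym xw≡1) (solve 2 (λ q w → (con 0ℚ :+ con 2ℚ :* q) :* w := con 0ℚ :+ con 2ℚ :* (q :* w)) refl q w))

odd⇒Odd₂ : ∀ {K} → Odd K → Odd₂ (fromℤ (ℤ.+ K))
odd⇒Odd₂ K-odd with odd⇒≡1+2s K-odd
... | s , refl = ≡₂-by (fromℤ (ℤ.+ s)) (ℤ₂-fromℤ (ℤ.+ s))
  (trans (fromℕ-+ 1 (s ℕ.* 2)) (cong (λ z → 1ℚ + z) (trans (fromℕ-* s 2) (*-comm (fromℤ (ℤ.+ s)) 2ℚ))))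

Odd₂*-≡₂ : ∀ {k y} → Odd₂ k → ℤ₂ y → k * y ≡₂ y
Odd₂*-≡₂ {y = y} (≡₂-by q q∈ℤ₂ refl) y∈ℤ₂ = ≡₂-by (q * y) (ℤ₂-* q∈ℤ₂ y∈ℤ₂)
  (solve 2 (λ q y → (con 1ℚ :+ con 2ℚ :* q) :* y := y :+ con 2ℚ :* (q :* y)) refl q y)

≡₂-cancel-Odd₂ : ∀ {k x y} → Odd₂ k → ℤ₂ y → k * x ≡₂ k * (k * y) → x ≡₂ y
≡₂-cancel-Odd₂ {k} {x} {y} k-odd y∈ℤ₂ kx≡₂kky =
  ≡₂-trans (subst₂ _≡₂_ (cancel x) (cancel (k * y)) (≡₂-*ˡ inv-ℤ₂ kx≡₂kky)) (Odd₂*-≡₂ k-odd y∈ℤ₂)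
  where
  open Invertible₂ (Odd₂⇒Invertible₂ k-odd)
  cancel : ∀ z → inv k * (k * z) ≡ z
  cancel z = begin
    inv k * (k * z)  ≡⟨ solve 3 (λ i k z → i :* (k :* z) := k :* i :* z) refl (inv k) k z ⟩
    k * inv k * z    ≡⟨ cong (_* z) inverseʳ ⟩
    1ℚ * z           ≡⟨ *-identityˡ z ⟩
    z                ∎

x+x²w-Even₂ : ∀ {x w} → ℤ₂ x → Odd₂ w → Even₂ (x + x * x * w)
x+x²w-Even₂ x∈ℤ₂ (≡₂-by g g∈ℤ₂ refl) with parity x∈ℤ₂
... | inj₁ (≡₂-by f f∈ℤ₂ refl) =
  ≡₂-by (f + 2ℚ * f * f * (1ℚ + 2ℚ * g))
        (ℤ₂-+ f∈ℤ₂ (ℤ₂-* (ℤ₂-* (ℤ₂-* ℤ₂-2 f∈ℤ₂) f∈ℤ₂) (ℤ₂-+ ℤ₂-1 (ℤ₂-* ℤ₂-2 g∈ℤ₂))))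
        (solve 2 (λ f g → let x = con 0ℚ :+ con 2ℚ :* f in
                          x :+ x :* x :* (con 1ℚ :+ con 2ℚ :* g)
                          := con 0ℚ :+ con 2ℚ :* (f :+ con 2ℚ :* f :* f :* (con 1ℚ :+ con 2ℚ :* g))) refl f g)
... | inj₂ (≡₂-by f f∈ℤ₂ refl) =
  ≡₂-by ((1ℚ + 2ℚ * f) * (1ℚ + f + g + 2ℚ * f * g))
        (ℤ₂-* (ℤ₂-+ ℤ₂-1 (ℤ₂-* ℤ₂-2 f∈ℤ₂))
              (ℤ₂-+ (ℤ₂-+ (ℤ₂-+ ℤ₂-1 f∈ℤ₂) g∈ℤ₂) (ℤ₂-* (ℤ₂-* ℤ₂-2 f∈ℤ₂) g∈ℤ₂)))
        (solve 2 (λ f g → let x = con 1ℚ :+ con 2ℚ :* f in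
                          x :+ x :* x :* (con 1ℚ :+ con 2ℚ :* g)
                          := con 0ℚ :+ con 2ℚ :* (x :* (con 1ℚ :+ f :+ g :+ con 2ℚ :* f :* g))) refl f g)

-- Bilinear forms and Jordan blocks

basis : ∀ {n} → Fin n → Vec' n
basis zero    zero    = 1ℚ
basis zero    (suc j) = 0ℚ
basis (suc k) zero    = 0ℚ
basis (suc k) (suc j) = basis k j

basis-InΛ : ∀ {n} (k : Fin n) → InΛ (basis k)
basis-InΛ zero    zero    = refl
basis-InΛ zero    (suc j) = refl
basis-InΛ (suc k) zero    = refl
basis-InΛ (suc k) (suc j) = basis-InΛ k j

sumF-basisʳ : ∀ {n} (f : Vec' n) k → sumF (λ j → f j * basis k j) ≡ f k
sumF-basisʳ {suc n} f zero = begin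
  f zero * 1ℚ + sumF (λ j → f (suc j) * 0ℚ)  ≡⟨ cong (f zero * 1ℚ +_) (sumF-zero (λ j → *-zeroʳ (f (suc j)))) ⟩
  f zero * 1ℚ + 0ℚ                            ≡⟨ solve 1 (λ x → x :* con 1ℚ :+ con 0ℚ := x) refl (f zero) ⟩
  f zero                                      ∎
sumF-basisʳ {suc n} f (suc k) = begin
  f zero * 0ℚ + sumF (λ j → f (suc j) * basis k j)  ≡⟨ cong (_+ sumF (λ j → f (suc j) * basis k j)) (*-zeroʳ (f zero)) ⟩
  0ℚ + sumF (λ j → f (suc j) * basis k j)           ≡⟨ +-identityˡ _ ⟩
  sumF (λ j → f (suc j) * basis k j)                ≡⟨ sumF-basisʳ (λ j → f (suc j)) k ⟩
  f (suc k)                                         ∎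

sumF-basisˡ : ∀ {n} (f : Vec' n) k → sumF (λ j → basis k j * f j) ≡ f k
sumF-basisˡ f k = trans (sumF-cong (λ j → *-comm (basis k j) (f j))) (sumF-basisʳ f k)

vecMat : ∀ {n} → Vec' n → Mat n → Vec' n
vecMat w G j = sumF (λ i → w i * G i j)

matVec : ∀ {n} → Mat n → Vec' n → Vec' n
matVec G y i = sumF (λ j → G i j * y j)

form-vecMat : ∀ {n} (G : Mat n) w y → form G w y ≡ sumF (λ j → vecMat w G j * y j)
form-vecMat G w y = trans (sumF-comm (λ i j → w i * G i j * y j))
  (sumF-cong (λ j → sumF-*ʳ (y j) (λ i → w i * G i j)))

form-matVec : ∀ {n} (G : Mat n) w y → form G w y ≡ sumF (λ i → w i * matVec G y i)
form-matVec G w y = sumF-cong λ i →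
  trans (sumF-cong (λ j → *-assoc (w i) (G i j) (y j))) (sumF-*ˡ (w i) (λ j → G i j * y j))

form-sym : ∀ {n} (G : Mat n) → Symmetric G → ∀ x y → form G x y ≡ form G y x
form-sym G G-sym x y = trans (sumF-comm (λ i j → x i * G i j * y j)) (sumF-cong λ j → sumF-cong λ i →
  trans (cong (λ g → x i * g * y j) (G-sym i j)) (solve 3 (λ a g b → a :* g :* b := b :* g :* a) refl (x i) (G j i) (y j)))

form-basisʳ : ∀ {n} (G : Mat n) u j → form G u (basis j) ≡ vecMat u G j
form-basisʳ G u j = trans (form-vecMat G u (basis j)) (sumF-basisʳ (vecMat u G) j)

form-basis : ∀ {n} (G : Mat n) k j → form G (basis k) (basis j) ≡ G k j
form-basis G k j = trans (form-basisʳ G (basis k) j) (sumF-basisˡ (λ i → G i j) k)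

form-*ˡ : ∀ {n} (G : Mat n) s x y → form G (λ k → s * x k) y ≡ s * form G x y
form-*ˡ G s x y = begin
  form G (λ k → s * x k) y                   ≡⟨ form-matVec G (λ k → s * x k) y ⟩
  sumF (λ i → s * x i * matVec G y i)        ≡⟨ sumF-cong (λ i → *-assoc s (x i) (matVec G y i)) ⟩
  sumF (λ i → s * (x i * matVec G y i))      ≡⟨ sumF-*ˡ s (λ i → x i * matVec G y i) ⟩
  s * sumF (λ i → x i * matVec G y i)        ≡⟨ cong (s *_) (form-matVec G x y) ⟨
  s * form G x y                             ∎

form-ℤ₂ : ∀ {n} (G : Mat n) → (∀ i j → ℤ₂ (G i j)) →
          ∀ x y → (∀ i → ℤ₂ (x i)) → (∀ i → ℤ₂ (y i)) → ℤ₂ (form G x y)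
form-ℤ₂ G G∈ℤ₂ x y x∈ℤ₂ y∈ℤ₂ =
  ℤ₂-sumF _ λ i → ℤ₂-sumF _ λ j → ℤ₂-* (ℤ₂-* (x∈ℤ₂ i) (G∈ℤ₂ i j)) (y∈ℤ₂ j)

TwoIntegral⇒ℤ₂ : ∀ {n} (G : Mat n) → TwoIntegral G → ∀ i j → ℤ₂ (G i j)
TwoIntegral⇒ℤ₂ G G-2int i j =
  InZp⇒ℤ₂ (subst (InZp 2) (form-basis G i j) (G-2int (basis i) (basis j) (basis-InΛ i) (basis-InΛ j)))

evenBlockDet : ℚ → ℚ → ℚ → ℚ
evenBlockDet a b c = 2ℚ * a * (2ℚ * c) - b * b

Odd₂-evenBlockDet : ∀ {a b c} → ℤ₂ a → Odd₂ b → ℤ₂ c → Odd₂ (evenBlockDet a b c)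
Odd₂-evenBlockDet {a} {c = c} a∈ℤ₂ (≡₂-by β β∈ℤ₂ refl) c∈ℤ₂ =
  ≡₂-by (2ℚ * a * c - 1ℚ - 2ℚ * β - 2ℚ * β * β)
    (ℤ₂-- (ℤ₂-- (ℤ₂-- (ℤ₂-* (ℤ₂-* ℤ₂-2 a∈ℤ₂) c∈ℤ₂) ℤ₂-1) (ℤ₂-* ℤ₂-2 β∈ℤ₂))
          (ℤ₂-* (ℤ₂-* ℤ₂-2 β∈ℤ₂) β∈ℤ₂))
    (solve 3 (λ a β c → con 2ℚ :* a :* (con 2ℚ :* c) :- (con 1ℚ :+ con 2ℚ :* β) :* (con 1ℚ :+ con 2ℚ :* β)
                        := con 1ℚ :+ con 2ℚ :* (con 2ℚ :* a :* c :- con 1ℚ :- con 2ℚ :* β :- con 2ℚ :* β :* β))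
           refl a β c)

Unit2⇒Odd₂ : ∀ {u} → Unit2 u → Odd₂ u
Unit2⇒Odd₂ {u} u-unit = inverse⇒Odd₂ (Unit2⇒ℤ₂ {u} u-unit) inv-ℤ₂ inverseʳ
  where open Invertible₂ (Unit2⇒Invertible₂ {u} u-unit)

evenBlock-Invertible₂ : ∀ {a b c} → ValidBlock (two a b c) → Invertible₂ (evenBlockDet a b c)
evenBlock-Invertible₂ {a} {b} {c} (a∈ℤ₂ , b-unit , c∈ℤ₂) =
  Odd₂⇒Invertible₂ (Odd₂-evenBlockDet (InZp⇒ℤ₂ {a} a∈ℤ₂) (Unit2⇒Odd₂ {b} b-unit) (InZp⇒ℤ₂ {c} c∈ℤ₂))

evenBlockInv₀ evenBlockInv₁ : ℚ → ℚ → ℚ → ℚ → ℚ → ℚ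
evenBlockInv₀ a b c d₀ d₁ = (2ℚ * c * d₀ - b * d₁) * inv (evenBlockDet a b c)
evenBlockInv₁ a b c d₀ d₁ = (2ℚ * a * d₁ - b * d₀) * inv (evenBlockDet a b c)

oneBlock-inverse : ∀ {u} → Unit2 u → ∀ d → u * (d * inv u) ≡ d
oneBlock-inverse {u} u-unit d = begin
  u * (d * inv u)  ≡⟨ solve 3 (λ u d i → u :* (d :* i) := d :* (u :* i)) refl u d (inv u) ⟩
  d * (u * inv u)  ≡⟨ cong (d *_) (Invertible₂.inverseʳ (Unit2⇒Invertible₂ {u} u-unit)) ⟩
  d * 1ℚ           ≡⟨ *-identityʳ d ⟩
  d                ∎

evenBlock-inverse₀ : ∀ {a b c} → ValidBlock (two a b c) → ∀ d₀ d₁ →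
  2ℚ * a * evenBlockInv₀ a b c d₀ d₁ + b * evenBlockInv₁ a b c d₀ d₁ ≡ d₀
evenBlock-inverse₀ {a} {b} {c} ab-valid d₀ d₁ = begin
  2ℚ * a * ((2ℚ * c * d₀ - b * d₁) * w) + b * ((2ℚ * a * d₁ - b * d₀) * w)
    ≡⟨ solve 6 (λ a b c d₀ d₁ w → con 2ℚ :* a :* ((con 2ℚ :* c :* d₀ :- b :* d₁) :* w)
                                   :+ b :* ((con 2ℚ :* a :* d₁ :- b :* d₀) :* w)
                                   := d₀ :* ((con 2ℚ :* a :* (con 2ℚ :* c) :- b :* b) :* w)) refl a b c d₀ d₁ w ⟩
  d₀ * (evenBlockDet a b c * w)  ≡⟨ cong (d₀ *_) (Invertible₂.inverseʳ (evenBlock-Invertible₂ {a} {b} {c} ab-valid)) ⟩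
  d₀ * 1ℚ                        ≡⟨ *-identityʳ d₀ ⟩
  d₀                             ∎
  where
  w : ℚ
  w = inv (evenBlockDet a b c)

evenBlock-inverse₁ : ∀ {a b c} → ValidBlock (two a b c) → ∀ d₀ d₁ →
  b * evenBlockInv₀ a b c d₀ d₁ + 2ℚ * c * evenBlockInv₁ a b c d₀ d₁ ≡ d₁
evenBlock-inverse₁ {a} {b} {c} ab-valid d₀ d₁ = begin
  b * ((2ℚ * c * d₀ - b * d₁) * w) + 2ℚ * c * ((2ℚ * a * d₁ - b * d₀) * w)
    ≡⟨ solve 6 (λ a b c d₀ d₁ w → b :* ((con 2ℚ :* c :* d₀ :- b :* d₁) :* w)
                                   :+ con 2ℚ :* c :* ((con 2ℚ :* a :* d₁ :- b :* d₀) :* w)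
                                   := d₁ :* ((con 2ℚ :* a :* (con 2ℚ :* c) :- b :* b) :* w)) refl a b c d₀ d₁ w ⟩
  d₁ * (evenBlockDet a b c * w)  ≡⟨ cong (d₁ *_) (Invertible₂.inverseʳ (evenBlock-Invertible₂ {a} {b} {c} ab-valid)) ⟩
  d₁ * 1ℚ                        ≡⟨ *-identityʳ d₁ ⟩
  d₁                             ∎
  where
  w : ℚ
  w = inv (evenBlockDet a b c)

blockInv : (bs : List Block) → Vec' (size bs) → Vec' (size bs)
blockInv (one u ∷ bs)     d zero          = d zero * inv u
blockInv (one u ∷ bs)     d (suc i)       = blockInv bs (λ k → d (suc k)) i
blockInv (two a b c ∷ bs) d zero          = evenBlockInv₀ a b c (d zero) (d (suc zero))
blockInv (two a b c ∷ bs) d (suc zero)    = evenBlockInv₁ a b c (d zero) (d (suc zero))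
blockInv (two a b c ∷ bs) d (suc (suc i)) = blockInv bs (λ k → d (suc (suc k))) i

+-sumF-0* : ∀ {n} x (f : Vec' n) → x + sumF (λ i → 0ℚ * f i) ≡ x
+-sumF-0* x f = trans (cong (x +_) (sumF-zero (λ i → *-zeroˡ (f i)))) (+-identityʳ x)

blockDiag-blockInv : ∀ bs → AllValid bs → ∀ d j → sumF (λ i → blockDiag bs j i * blockInv bs d i) ≡ d j
blockDiag-blockInv (one u ∷ bs) (u-unit , _) d zero =
  trans (+-sumF-0* (u * (d zero * inv u)) (blockInv bs (λ k → d (suc k)))) (oneBlock-inverse {u} u-unit (d zero))
blockDiag-blockInv (one u ∷ bs) (_ , bs-valid) d (suc j) =
  trans (0*-+ (d zero * inv u) _) (blockDiag-blockInv bs bs-valid (λ k → d (suc k)) j)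
blockDiag-blockInv (two a b c ∷ bs) (ab-valid , _) d zero =
  trans (cong (2ℚ * a * blockInv (two a b c ∷ bs) d zero +_) (+-sumF-0* (b * blockInv (two a b c ∷ bs) d (suc zero)) rest))
        (evenBlock-inverse₀ {a} {b} {c} ab-valid (d zero) (d (suc zero)))
  where
  rest : Vec' (size bs)
  rest = blockInv bs (λ k → d (suc (suc k)))
blockDiag-blockInv (two a b c ∷ bs) (ab-valid , _) d (suc zero) =
  trans (cong (b * blockInv (two a b c ∷ bs) d zero +_) (+-sumF-0* (2ℚ * c * blockInv (two a b c ∷ bs) d (suc zero)) rest))
        (evenBlock-inverse₁ {a} {b} {c} ab-valid (d zero) (d (suc zero)))
  where
  rest : Vec' (size bs)
  rest = blockInv bs (λ k → d (suc (suc k)))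
blockDiag-blockInv (two a b c ∷ bs) (_ , bs-valid) d (suc (suc j)) =
  trans (0*-+ (blockInv (two a b c ∷ bs) d zero) _) (trans (0*-+ (blockInv (two a b c ∷ bs) d (suc zero)) _)
    (blockDiag-blockInv bs bs-valid (λ k → d (suc (suc k))) j))

blockInv-ℤ₂ : ∀ bs → AllValid bs → ∀ d → (∀ i → ℤ₂ (d i)) → ∀ i → ℤ₂ (blockInv bs d i)
blockInv-ℤ₂ (one u ∷ bs) (u-unit , _) d d∈ℤ₂ zero =
  ℤ₂-* (d∈ℤ₂ zero) (Invertible₂.inv-ℤ₂ (Unit2⇒Invertible₂ {u} u-unit))
blockInv-ℤ₂ (one u ∷ bs) (_ , bs-valid) d d∈ℤ₂ (suc i) =
  blockInv-ℤ₂ bs bs-valid (λ k → d (suc k)) (λ k → d∈ℤ₂ (suc k)) i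
blockInv-ℤ₂ (two a b c ∷ bs) (ab-valid@(a∈ℤ₂ , b-unit , c∈ℤ₂) , _) d d∈ℤ₂ zero =
  ℤ₂-* (ℤ₂-- (ℤ₂-* (ℤ₂-* ℤ₂-2 (InZp⇒ℤ₂ {c} c∈ℤ₂)) (d∈ℤ₂ zero))
             (ℤ₂-* (Unit2⇒ℤ₂ {b} b-unit) (d∈ℤ₂ (suc zero))))
       (Invertible₂.inv-ℤ₂ (evenBlock-Invertible₂ {a} {b} {c} ab-valid))
blockInv-ℤ₂ (two a b c ∷ bs) (ab-valid@(a∈ℤ₂ , b-unit , c∈ℤ₂) , _) d d∈ℤ₂ (suc zero) =
  ℤ₂-* (ℤ₂-- (ℤ₂-* (ℤ₂-* ℤ₂-2 (InZp⇒ℤ₂ {a} a∈ℤ₂)) (d∈ℤ₂ (suc zero)))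
             (ℤ₂-* (Unit2⇒ℤ₂ {b} b-unit) (d∈ℤ₂ zero)))
       (Invertible₂.inv-ℤ₂ (evenBlock-Invertible₂ {a} {b} {c} ab-valid))
blockInv-ℤ₂ (two a b c ∷ bs) (_ , bs-valid) d d∈ℤ₂ (suc (suc i)) =
  blockInv-ℤ₂ bs bs-valid (λ k → d (suc (suc k))) (λ k → d∈ℤ₂ (suc (suc k))) i

-- Writing d = u/2 + e, d²/u = u/4 + (e + e²/u), and e + e²/u ∈ 2ℤ₂ since 1/u is odd.
oneBlock-quadratic : ∀ {u d} → Unit2 u → 2ℚ * d ≡₂ u → d * inv u * d ≡₂ u * ¼
oneBlock-quadratic {u} {d} u-unit (≡₂-by e e∈ℤ₂ 2d≡u+2e) =
  subst₂ _≡₂_ (sym value) (+-identityʳ (u * ¼)) (≡₂-+ (≡₂-refl {u * ¼}) (x+x²w-Even₂ e∈ℤ₂ w-odd))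
  where
  open Invertible₂ (Unit2⇒Invertible₂ {u} u-unit)
  w : ℚ
  w = inv u
  w-odd : Odd₂ w
  w-odd = inverse⇒Odd₂ inv-ℤ₂ (Unit2⇒ℤ₂ {u} u-unit) (trans (*-comm w u) inverseʳ)
  d≡½u+e : d ≡ ½ * u + e
  d≡½u+e = begin
    d                  ≡⟨ solve 1 (λ d → d := con ½ :* (con 2ℚ :* d)) refl d ⟩
    ½ * (2ℚ * d)       ≡⟨ cong (½ *_) 2d≡u+2e ⟩
    ½ * (u + 2ℚ * e)   ≡⟨ solve 2 (λ u e → con ½ :* (u :+ con 2ℚ :* e) := con ½ :* u :+ e) refl u e ⟩
    ½ * u + e          ∎
  value : d * w * d ≡ u * ¼ + (e + e * e * w)
  value = begin
    d * w * d                                  ≡⟨ cong (λ x → x * w * x) d≡½u+e ⟩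
    (½ * u + e) * w * (½ * u + e)
      ≡⟨ solve 3 (λ u e w → (con ½ :* u :+ e) :* w :* (con ½ :* u :+ e)
                            := u :* con ¼ :* (u :* w) :+ e :* (u :* w) :+ e :* e :* w) refl u e w ⟩
    u * ¼ * (u * w) + e * (u * w) + e * e * w  ≡⟨ cong (λ t → u * ¼ * t + e * t + e * e * w) inverseʳ ⟩
    u * ¼ * 1ℚ + e * 1ℚ + e * e * w
      ≡⟨ solve 3 (λ u e w → u :* con ¼ :* con 1ℚ :+ e :* con 1ℚ :+ e :* e :* w
                            := u :* con ¼ :+ (e :+ e :* e :* w)) refl u e w ⟩
    u * ¼ + (e + e * e * w)                    ∎

2*≡₂2*⇒ℤ₂ : ∀ {x a} → 2ℚ * x ≡₂ 2ℚ * a → ℤ₂ a → ℤ₂ x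
2*≡₂2*⇒ℤ₂ {x} {a} (≡₂-by e e∈ℤ₂ 2x≡2a+2e) a∈ℤ₂ = ℤ₂-resp (sym x≡a+e) (ℤ₂-+ a∈ℤ₂ e∈ℤ₂)
  where
  x≡a+e : x ≡ a + e
  x≡a+e = begin
    x                          ≡⟨ solve 1 (λ x → x := con ½ :* (con 2ℚ :* x)) refl x ⟩
    ½ * (2ℚ * x)               ≡⟨ cong (½ *_) 2x≡2a+2e ⟩
    ½ * (2ℚ * a + 2ℚ * e)      ≡⟨ solve 2 (λ a e → con ½ :* (con 2ℚ :* a :+ con 2ℚ :* e) := a :+ e) refl a e ⟩
    a + e                      ∎

twoBlock-quadratic : ∀ {a b c d₀ d₁} → ValidBlock (two a b c) →
  2ℚ * d₀ ≡₂ 2ℚ * a → 2ℚ * d₁ ≡₂ 2ℚ * c →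
  Even₂ (evenBlockInv₀ a b c d₀ d₁ * d₀ + evenBlockInv₁ a b c d₀ d₁ * d₁)
twoBlock-quadratic {a} {b} {c} {d₀} {d₁} ab-valid@(a∈ℤ₂ , b-unit , c∈ℤ₂) 2d₀≡₂2a 2d₁≡₂2c =
  subst (_≡₂ 0ℚ) (sym value)
    (2*-Even₂ (ℤ₂-* (Invertible₂.inv-ℤ₂ (evenBlock-Invertible₂ {a} {b} {c} ab-valid)) q∈ℤ₂))
  where
  w q : ℚ
  w = inv (evenBlockDet a b c)
  q = c * d₀ * d₀ - b * d₀ * d₁ + a * d₁ * d₁
  d₀∈ℤ₂ : ℤ₂ d₀
  d₀∈ℤ₂ = 2*≡₂2*⇒ℤ₂ 2d₀≡₂2a (InZp⇒ℤ₂ {a} a∈ℤ₂)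
  d₁∈ℤ₂ : ℤ₂ d₁
  d₁∈ℤ₂ = 2*≡₂2*⇒ℤ₂ 2d₁≡₂2c (InZp⇒ℤ₂ {c} c∈ℤ₂)
  q∈ℤ₂ : ℤ₂ q
  q∈ℤ₂ = ℤ₂-+ (ℤ₂-- (ℤ₂-* (ℤ₂-* (InZp⇒ℤ₂ {c} c∈ℤ₂) d₀∈ℤ₂) d₀∈ℤ₂)
                    (ℤ₂-* (ℤ₂-* (Unit2⇒ℤ₂ {b} b-unit) d₀∈ℤ₂) d₁∈ℤ₂))
               (ℤ₂-* (ℤ₂-* (InZp⇒ℤ₂ {a} a∈ℤ₂) d₁∈ℤ₂) d₁∈ℤ₂)
  value : (2ℚ * c * d₀ - b * d₁) * w * d₀ + (2ℚ * a * d₁ - b * d₀) * w * d₁ ≡ 2ℚ * (w * q)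
  value = solve 6 (λ a b c d₀ d₁ w → (con 2ℚ :* c :* d₀ :- b :* d₁) :* w :* d₀
                                     :+ (con 2ℚ :* a :* d₁ :- b :* d₀) :* w :* d₁
                                     := con 2ℚ :* (w :* (c :* d₀ :* d₀ :- b :* d₀ :* d₁ :+ a :* d₁ :* d₁)))
                  refl a b c d₀ d₁ w

blockQuadratic : (bs : List Block) → Vec' (size bs) → ℚ
blockQuadratic bs d = sumF (λ i → blockInv bs d i * d i)

blockQuadratic-≡₂ : ∀ bs → AllValid bs → ∀ d → (∀ i → 2ℚ * d i ≡₂ blockDiag bs i i) →
                    blockQuadratic bs d ≡₂ oddSum bs * ¼
blockQuadratic-≡₂ [] _ d _ = ≡₂-refl
blockQuadratic-≡₂ (one u ∷ bs) (u-unit , bs-valid) d 2d≡₂B =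
  subst (blockQuadratic (one u ∷ bs) d ≡₂_) (sym (*-distribʳ-+ ¼ u (oddSum bs)))
    (≡₂-+ (oneBlock-quadratic {u} {d zero} u-unit (2d≡₂B zero))
          (blockQuadratic-≡₂ bs bs-valid (λ k → d (suc k)) (λ i → 2d≡₂B (suc i))))
blockQuadratic-≡₂ (two a b c ∷ bs) (ab-valid , bs-valid) d 2d≡₂B =
  subst₂ _≡₂_ (+-assoc X₀d₀ X₁d₁ rest) (+-identityˡ (oddSum bs * ¼))
    (≡₂-+ (twoBlock-quadratic {a} {b} {c} ab-valid (2d≡₂B zero) (2d≡₂B (suc zero)))
          (blockQuadratic-≡₂ bs bs-valid (λ k → d (suc (suc k))) (λ i → 2d≡₂B (suc (suc i)))))
  where
  X₀d₀ X₁d₁ rest : ℚ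
  X₀d₀ = blockInv (two a b c ∷ bs) d zero * d zero
  X₁d₁ = blockInv (two a b c ∷ bs) d (suc zero) * d (suc zero)
  rest = blockQuadratic bs (λ k → d (suc (suc k)))

-- Duals and shadows in a Jordan basis

form-linearʳ : ∀ {n} (G P : Mat n) (a : Vec' n) w x →
  form G w (λ m → x m - sumF (λ i → a i * P m i)) ≡ form G w x - sumF (λ i → a i * form G w (col P i))
form-linearʳ {n} G P a w x = begin
  form G w (λ m → x m - S m)
    ≡⟨ form-vecMat G w _ ⟩
  sumF (λ m → g m * (x m - S m))
    ≡⟨ sumF-cong (λ m → solve 3 (λ g x s → g :* (x :- s) := g :* x :+ :- (g :* s)) refl (g m) (x m) (S m)) ⟩
  sumF (λ m → g m * x m + - (g m * S m))
    ≡⟨ sumF-+ (λ m → g m * x m) (λ m → - (g m * S m)) ⟩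
  sumF (λ m → g m * x m) + sumF (λ m → - (g m * S m))
    ≡⟨ cong₂ _+_ (sym (form-vecMat G w x)) (sumF-neg (λ m → g m * S m)) ⟩
  form G w x - sumF (λ m → g m * S m)
    ≡⟨ cong (λ s → form G w x - s) gS≡ ⟩
  form G w x - sumF (λ i → a i * form G w (col P i)) ∎
  where
  g S : Vec' n
  g = vecMat w G
  S m = sumF (λ i → a i * P m i)
  gS≡ : sumF (λ m → g m * S m) ≡ sumF (λ i → a i * form G w (col P i))
  gS≡ = begin
    sumF (λ m → g m * S m)                         ≡⟨ sumF-cong (λ m → sym (sumF-*ˡ (g m) (λ i → a i * P m i))) ⟩
    sumF (λ m → sumF (λ i → g m * (a i * P m i)))  ≡⟨ sumF-comm (λ m i → g m * (a i * P m i)) ⟩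
    sumF (λ i → sumF (λ m → g m * (a i * P m i)))
      ≡⟨ sumF-cong (λ i → trans (sumF-cong (λ m → solve 3 (λ g a p → g :* (a :* p) := a :* (g :* p))
                                                            refl (g m) (a i) (P m i)))
                                (sumF-*ˡ (a i) (λ m → g m * P m i))) ⟩
    sumF (λ i → a i * sumF (λ m → g m * P m i))
      ≡⟨ sumF-cong (λ i → cong (a i *_) (sym (form-vecMat G w (col P i)))) ⟩
    sumF (λ i → a i * form G w (col P i)) ∎

orthogonal-to-columns⇒radical : ∀ {n} (G P : Mat n) → det P ≢ 0ℚ → ∀ r →
  (∀ j → form G (col P j) r ≡ 0ℚ) → ∀ w → form G w r ≡ 0ℚ
orthogonal-to-columns⇒radical G P det≢0 r P⊥r w = begin
  form G w r                        ≡⟨ form-matVec G w r ⟩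
  sumF (λ i → w i * matVec G r i)   ≡⟨ sumF-zero (λ i → trans (cong (w i *_) (Gr≡0 i)) (*-zeroʳ (w i))) ⟩
  0ℚ                                ∎
  where
  Gr≡0 : ∀ i → matVec G r i ≡ 0ℚ
  Gr≡0 = det≢0⇒rows-independent P det≢0 (matVec G r) λ j →
    trans (sumF-cong (λ k → *-comm (matVec G r k) (P k j))) (trans (sym (form-matVec G (col P j) r)) (P⊥r j))

ℤ₂-form : ∀ {n} (G : Mat n) u y → (∀ j → ℤ₂ (form G u (basis j))) → (∀ k → ℤ₂ (y k)) → ℤ₂ (form G u y)
ℤ₂-form G u y u·e∈ℤ₂ y∈ℤ₂ = ℤ₂-resp (sym (form-vecMat G u y))
  (ℤ₂-sumF _ λ j → ℤ₂-* (ℤ₂-resp (form-basisʳ G u j) (u·e∈ℤ₂ j)) (y∈ℤ₂ j))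

InPiDual-twoSet⇒ℤ₂ : ∀ {n} (G : Mat n) u → InPiDual G twoSet u → ∀ j → ℤ₂ (form G u (basis j))
InPiDual-twoSet⇒ℤ₂ G u u∈Λ* j = InZp⇒ℤ₂ (proj₁ (u∈Λ* 2 2-prime) refl (basis j) (basis-InΛ j))

integral⇒InPiDual : ∀ {n} (G : Mat n) → Symmetric G → ∀ u → (∀ k → Integer (u k)) →
  (∀ k j → Integer (u k * G k j)) → ∀ Π → InPiDual G Π u
integral⇒InPiDual G G-sym u u∈ℤ uG∈ℤ Π p p-prime =
  (λ _ w w∈Λ → IsInt⇒InZp {q = form G u w} p-prime (Integer⇒IsInt (pairs-Λ w w∈Λ))) ,
  (λ _ y y∈Λ* → IsInt⇒InZp {q = form G u y} p-prime (Integer⇒IsInt (pairs-Λ* y y∈Λ*)))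
  where
  pairs-Λ : ∀ w → InΛ w → Integer (form G u w)
  pairs-Λ w w∈Λ = Integer-sumF _ λ k → Integer-sumF _ λ j → Integer-* (uG∈ℤ k j) (IsInt⇒Integer (w∈Λ j))
  Gy≡ : ∀ y k → matVec G y k ≡ form G y (basis k)
  Gy≡ y k = trans (sumF-cong λ j → trans (cong (_* y j) (G-sym k j)) (*-comm (G j k) (y j))) (sym (form-basisʳ G y k))
  pairs-Λ* : ∀ y → InDual G y → Integer (form G u y)
  pairs-Λ* y y∈Λ* = Integer-resp (sym (form-matVec G u y)) (Integer-sumF _ λ k →
    Integer-* (u∈ℤ k) (Integer-resp (sym (Gy≡ y k)) (IsInt⇒Integer (y∈Λ* (basis k) (basis-InΛ k)))))

oddMultiple-InPiDual : ∀ {n} (G : Mat n) → Symmetric G → (∀ i j → ℤ₂ (G i j)) → ∀ x → (∀ i → ℤ₂ (x i)) →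
  ∃ λ K → Odd K × ∀ Π → InPiDual G Π (λ m → fromℤ (ℤ.+ K) * x m)
oddMultiple-InPiDual G G-sym G∈ℤ₂ x x∈ℤ₂ =
  let K , K-odd , Kx∈ℤ = clearVector x x∈ℤ₂
      L , L-odd , LG∈ℤ = clearMatrix G G∈ℤ₂
  in L ℕ.* K , odd-* L-odd K-odd , integral⇒InPiDual G G-sym (λ m → fromℤ (ℤ.+ (L ℕ.* K)) * x m)
       (λ m → Clears-* L (Kx∈ℤ m))
       (λ m j → Integer-resp (reassociate K L (x m) (G m j)) (Integer-* (Kx∈ℤ m) (LG∈ℤ m j)))
  where
  reassociate : ∀ K L p g → fromℤ (ℤ.+ K) * p * (fromℤ (ℤ.+ L) * g) ≡ fromℤ (ℤ.+ (L ℕ.* K)) * p * g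
  reassociate K L p g =
    trans (solve 4 (λ k l p g → k :* p :* (l :* g) := l :* k :* p :* g) refl (fromℤ (ℤ.+ K)) (fromℤ (ℤ.+ L)) p g)
          (cong (λ y → y * p * g) (sym (fromℕ-* L K)))

PiShadow-1⇒≡₂ : ∀ {n} (G : Mat n) Π v → InPiShadow G Π 1 v →
  ∀ u → InPiDual G (complement Π) u → 2ℚ * form G u v ≡₂ form G u u
PiShadow-1⇒≡₂ G Π v (v∈S , v∈√S) u u∈Λ* with Π 2
... | true  = CongMod2⇒≡₂ (v∈S refl u u∈Λ*)
... | false = CongMod2⇒≡₂ (subst (CongMod2 2 (2ℚ * form G u v)) (*-identityˡ (form G u u)) (v∈√S refl u u∈Λ*))

PiShadow-1-scaled : ∀ {n} (G : Mat n) → Symmetric G → ∀ Π v → InPiShadow G Π 1 v →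
  ∀ k x → InPiDual G (complement Π) (λ m → k * x m) → k * (2ℚ * form G x v) ≡₂ k * (k * form G x x)
PiShadow-1-scaled G G-sym Π v v∈S k x kx∈Λ* =
  subst₂ _≡₂_ kxv≡ kxkx≡ (PiShadow-1⇒≡₂ G Π v v∈S (λ m → k * x m) kx∈Λ*)
  where
  kxv≡ : 2ℚ * form G (λ m → k * x m) v ≡ k * (2ℚ * form G x v)
  kxv≡ = trans (cong (2ℚ *_) (form-*ˡ G k x v))
               (solve 2 (λ k f → con 2ℚ :* (k :* f) := k :* (con 2ℚ :* f)) refl k (form G x v))
  kxkx≡ : form G (λ m → k * x m) (λ m → k * x m) ≡ k * (k * form G x x)
  kxkx≡ = begin
    form G (λ m → k * x m) (λ m → k * x m)  ≡⟨ form-*ˡ G k x (λ m → k * x m) ⟩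
    k * form G x (λ m → k * x m)            ≡⟨ cong (k *_) (form-sym G G-sym x (λ m → k * x m)) ⟩
    k * form G (λ m → k * x m) x            ≡⟨ cong (k *_) (form-*ˡ G k x x) ⟩
    k * (k * form G x x)                    ∎

module JordanBasis (bs : List Block) (bs-valid : AllValid bs)
                   (G : Mat (size bs)) (G-sym : Symmetric G) (G∈ℤ₂ : ∀ i j → ℤ₂ (G i j))
                   (P : Mat (size bs)) (P∈ℤ₂ : ∀ i j → ℤ₂ (P i j)) (det-P≢0 : det P ≢ 0ℚ)
                   (PᵀGP≡B : ∀ i j → form G (col P i) (col P j) ≡ blockDiag bs i j) where

  pairings : Vec' (size bs) → Vec' (size bs)
  pairings x i = form G (col P i) x

  coordinates : Vec' (size bs) → Vec' (size bs)
  coordinates x = blockInv bs (pairings x)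

  -- x − Σᵢ aᵢ pᵢ is orthogonal to every column of P, hence to everything since det P ≢ 0.
  form-expand : ∀ w x → form G w x ≡ sumF (λ i → coordinates x i * form G w (col P i))
  form-expand w x = begin
    form G w x                   ≡⟨ solve 2 (λ f s → f := f :- s :+ s) refl (form G w x) S ⟩
    form G w x - S + S           ≡⟨ cong (_+ S) (form-linearʳ G P a w x) ⟨
    form G w r + S               ≡⟨ cong (_+ S) (orthogonal-to-columns⇒radical G P det-P≢0 r P⊥r w) ⟩
    0ℚ + S                       ≡⟨ +-identityˡ S ⟩
    S                            ∎
    where
    a r : Vec' (size bs)
    a = coordinates x
    r m = x m - sumF (λ i → a i * P m i)
    S : ℚ
    S = sumF (λ i → a i * form G w (col P i))
    P⊥r : ∀ j → form G (col P j) r ≡ 0ℚ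
    P⊥r j = begin
      form G (col P j) r
        ≡⟨ form-linearʳ G P a (col P j) x ⟩
      pairings x j - sumF (λ i → a i * form G (col P j) (col P i))
        ≡⟨ cong (λ s → pairings x j - s) (sumF-cong (λ i → trans (cong (a i *_) (PᵀGP≡B j i)) (*-comm (a i) _))) ⟩
      pairings x j - sumF (λ i → blockDiag bs j i * a i)
        ≡⟨ cong (λ s → pairings x j - s) (blockDiag-blockInv bs bs-valid (pairings x) j) ⟩
      pairings x j - pairings x j
        ≡⟨ +-inverseʳ (pairings x j) ⟩
      0ℚ ∎

  form-self : ∀ v → form G v v ≡ blockQuadratic bs (pairings v)
  form-self v = trans (form-expand v v) (sumF-cong λ i → cong (coordinates v i *_) (form-sym G G-sym v (col P i)))

  column-ℤ₂ : ∀ i → ℤ₂ (form G (col P i) (col P i))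
  column-ℤ₂ i = form-ℤ₂ G G∈ℤ₂ (col P i) (col P i) (λ k → P∈ℤ₂ k i) (λ k → P∈ℤ₂ k i)

  LevelProp-1 : LevelProp G 1
  LevelProp-1 u w u∈Λ* w∈Λ* = ℤ₂⇒InZp (ℤ₂-resp (sym (*-identityˡ (form G u w)))
    (ℤ₂-resp (sym (form-expand u w)) (ℤ₂-sumF _ λ i → ℤ₂-* (coordinates-ℤ₂ i) (pairs-column u u∈Λ* i))))
    where
    pairs-column : ∀ x → InPiDual G twoSet x → ∀ i → ℤ₂ (form G x (col P i))
    pairs-column x x∈Λ* i = ℤ₂-form G x (col P i) (InPiDual-twoSet⇒ℤ₂ G x x∈Λ*) (λ k → P∈ℤ₂ k i)
    coordinates-ℤ₂ : ∀ i → ℤ₂ (coordinates w i)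
    coordinates-ℤ₂ = blockInv-ℤ₂ bs bs-valid (pairings w)
      (λ i → ℤ₂-resp (form-sym G G-sym w (col P i)) (pairs-column w w∈Λ* i))

  -- An odd multiple K pᵢ lies in every Π-dual; divide its shadow congruence by the unit K.
  shadow-pairings : ∀ Π v → InPiShadow G Π 1 v → ∀ i → 2ℚ * pairings v i ≡₂ blockDiag bs i i
  shadow-pairings Π v v∈S i =
    let K , K-odd , Kx∈Λ* = oddMultiple-InPiDual G G-sym G∈ℤ₂ (col P i) (λ m → P∈ℤ₂ m i)
    in subst (2ℚ * pairings v i ≡₂_) (PᵀGP≡B i i) (≡₂-cancel-Odd₂ (odd⇒Odd₂ K-odd) (column-ℤ₂ i)
         (PiShadow-1-scaled G G-sym Π v v∈S (fromℤ (ℤ.+ K)) (col P i) (Kx∈Λ* (complement Π))))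

oddity-quarter : ∀ s t → CongMod2 8 s (t / 1) → s * ¼ ≡₂ t / 4
oddity-quarter s t s≡t = ≡₂-by ((s - fromℤ t) * (ℤ.+ 1 / 8)) (InZp⇒ℤ₂ s≡t) (trans
  (solve 2 (λ s t → s :* con ¼ := t :* con ¼ :+ con 2ℚ :* ((s :- t) :* con (ℤ.+ 1 / 8))) refl s (fromℤ t))
  (cong (_+ 2ℚ * ((s - fromℤ t) * (ℤ.+ 1 / 8))) (fromℤ*¼ t)))

twoLevel≡1 : ∀ {n} {G : Mat n} {l} → IsTwoLevel G l → LevelProp G 1 → l ≡ 1
twoLevel≡1 (1≤l , _ , minimal) level-1 = ℕ.≤-antisym (minimal 1 (ℕ.s≤s ℕ.z≤n) level-1) 1≤l

theorem7 : (n : ℕ) (G : Mat n) → Symmetric G → TwoIntegral G → Unit2 (det G) →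
    (Π : PrimeSet) (t : ℤ) → HasOddity G t → (l : ℕ) → IsTwoLevel G l →
    (v : Vec' n) → InPiShadow G Π l v → CongMod2 2 (form G v v) (t / 4)
-- The hypothesis on det G is unused: 2-adic unimodularity already follows from HasOddity.
theorem7 _ G G-sym G-2int _ Π t (P , bs , refl , P-2int , det-P-unit , bs-valid , PᵀGP≡B , oddity) l l-level v v∈S =
  ≡₂⇒CongMod2 (subst (_≡₂ t / 4) (sym (form-self v)) (≡₂-trans vv≡₂oddity/4 (oddity-quarter (oddSum bs) t oddity)))
  where
  open JordanBasis bs bs-valid G G-sym (TwoIntegral⇒ℤ₂ G G-2int) P (λ i j → InZp⇒ℤ₂ (P-2int i j)) (Unit2⇒≢0 det-P-unit)
    (λ i j → trans (PᵀGP≡B i j) (cong₂ (blockDiag bs) (cast-is-id refl i) (cast-is-id refl j)))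
  l≡1 : l ≡ 1
  l≡1 = twoLevel≡1 l-level LevelProp-1
  vv≡₂oddity/4 : blockQuadratic bs (pairings v) ≡₂ oddSum bs * ¼
  vv≡₂oddity/4 = blockQuadratic-≡₂ bs bs-valid (pairings v)
    (shadow-pairings Π v (subst (λ l → InPiShadow G Π l v) l≡1 v∈S))
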